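{- Let $k\ge1$ and $n\ge1$. Let $\tau_n$ be a uniformly random $(k+1)$-ary increasing tree of order $n$ and $\sigma_n$ a uniformly random $k$-Stirling permutation of order $n$. Then \begin{align*} \mathbb{E}L_{n,j}&=\tfrac{kn+1}{k+1}, && 1\le j\le k+1,\\ \mathbb{E}D_{n,j}&=\tfrac{n-1}{k+1}, && 1\le j\le k+1,\\ \mathbb{E}X_{n,j}&=\mathbb{E}Y_{n,j}=\tfrac{n-1}{k+1}, && 1\le j\le k,\\ \mathbb{E}Z_{n,j}&=\tfrac{kn+1}{k+1}, && 1\le j\le k-1,\\ \mathbb{E}X_n&=\mathbb{E}Y_n=\tfrac{kn+1}{k+1},\\ \mathbb{E}Z_n&=(k-1)\tfrac{kn+1}{k+1}, \end{align*} where $L_{n,j},D_{n,j}$ refer to $\tau_n$ and $X_{n,j},Y_{n,j},Z_{n,j},X_n,Y_n,Z_n$ refer to $\sigma_n$.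
   Context: A $(k+1)$-ary increasing tree of order $n$ is a rooted tree on $\{1,\dots,n\}$, root $1$, labels increasing along paths away from the root, in which every vertex has $k+1$ positions numbered $1,\dots,k+1$, each empty or occupied by exactly one child, each non-root vertex occupying exactly one position of its parent. $D_{n,j}$ is the number of vertices occupying position $j$ of their parent; $L_{n,j}$ is the number of pairs (vertex $v$, position $j$ of $v$) with that position empty. A $k$-Stirling permutation of order $n$ is a word $a_1\cdots a_{kn}$ in which each of $1,\dots,n$ occurs exactly $k$ times, such that for each $i$ every entry between two occurrences of $i$ is at least $i$. Set $a_0=a_{kn+1}=0$. An index $i\in\{0,\dots,kn\}$ is an ascent if $a_i<a_{i+1}$, a descent if $a_i>a_{i+1}$, a plateau if $a_i=a_{i+1}$; $X_n,Y_n,Z_n$ are their total numbers. For $1\le i\le kn$: $i$ is a $j$-ascent if it is an ascent and $a_i$ is the $j$-th occurrence (from the left) of its value; a $j$-plateau if it is a plateau and $a_i$ is the $j$-th occurrence of its value; a $j$-descent if $i<kn$, $i$ is a descent and $a_{i+1}$ is the $j$-th occurrence of its value. $X_{n,j},Y_{n,j},Z_{n,j}$ are the numbers of $j$-ascents, $j$-descents, $j$-plateaux. -}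

module Defs where

open import Data.Nat using (ℕ; zero; suc; _+_; _*_; _∸_; _≤_; _<_; _<ᵇ_; _≡ᵇ_)
open import Data.Bool using (Bool; true; false; if_then_else_; _∧_; not)
open import Data.List using (List; []; _∷_; length; map; upTo; lookup)
open import Data.Bool.ListAction using (any)
open import Data.List.Relation.Unary.All using (All)
open import Data.List.Relation.Unary.Unique.Propositional using (Unique)
open import Data.List.Membership.Propositional using (_∈_)
open import Data.Product using (_×_; _,_; proj₁; proj₂)
open import Data.Fin using (Fin; toℕ)
open import Function.Bundles using (_⇔_)
open import Relation.Binary.PropositionalEquality using (_≡_)

countB : {A : Set} → (A → Bool) → List A → ℕ
countB p []       = 0
countB p (x ∷ xs) = if p x then suc (countB p xs) else countB p xs

fromTo : ℕ → ℕ → List ℕ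
fromTo lo hi = map (lo +_) (upTo (suc hi ∸ lo))

-- A tree is encoded by the list of its non-root vertices 2,3,...,n in
-- order: the entry at (0-based) index m is the pair (p , j) meaning that
-- vertex m+2 is the child of vertex p sitting at position j of p.
-- Increasing labels along paths <=> every parent label is smaller than
-- the child label; each position holds at most one child <=> the pairs
-- are pairwise distinct.

IsIncTree : ℕ → ℕ → List (ℕ × ℕ) → Set
IsIncTree k n t =
  (length t ≡ n ∸ 1) ×
  ((m : Fin (length t)) →
     (1 ≤ proj₁ (lookup t m)) × (proj₁ (lookup t m) ≤ suc (toℕ m)) ×
     (1 ≤ proj₂ (lookup t m)) × (proj₂ (lookup t m) ≤ suc k)) ×
  Unique t

Dstat : ℕ → List (ℕ × ℕ) → ℕ
Dstat j t = countB (λ e → proj₂ e ≡ᵇ j) t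

Lstat : ℕ → ℕ → List (ℕ × ℕ) → ℕ
Lstat n j t =
  countB (λ v → not (any (λ e → (proj₁ e ≡ᵇ v) ∧ (proj₂ e ≡ᵇ j)) t)) (fromTo 1 n)

-- k-Stirling permutations, words given as lists.
-- at w i = a_i with 1-based indexing, and a_0 = a_{kn+1} = 0
-- (any out-of-range index gives 0).

at : List ℕ → ℕ → ℕ
at []       _             = 0
at (x ∷ xs) zero          = 0
at (x ∷ xs) (suc zero)    = x
at (x ∷ xs) (suc (suc i)) = at xs (suc i)

IsStirling : ℕ → ℕ → List ℕ → Set
IsStirling k n w =
  All (λ a → (1 ≤ a) × (a ≤ n)) w ×
  ((i : ℕ) → 1 ≤ i → i ≤ n → countB (λ a → a ≡ᵇ i) w ≡ k) ×
  ((p q r : ℕ) → 1 ≤ p → p < q → q < r → r ≤ length w →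
     at w p ≡ at w r → at w r ≤ at w q)

occ : List ℕ → ℕ → ℕ
occ w i = countB (λ m → at w m ≡ᵇ at w i) (fromTo 1 i)

isAsc isDesc isPlat : List ℕ → ℕ → Bool
isAsc  w i = at w i <ᵇ at w (suc i)
isDesc w i = at w (suc i) <ᵇ at w i
isPlat w i = at w i ≡ᵇ at w (suc i)

Xstat Ystat Zstat : List ℕ → ℕ
Xstat w = countB (isAsc w)  (fromTo 0 (length w))
Ystat w = countB (isDesc w) (fromTo 0 (length w))
Zstat w = countB (isPlat w) (fromTo 0 (length w))

Xj Yj Zj : ℕ → List ℕ → ℕ
Xj j w = countB (λ i → isAsc w i ∧ (occ w i ≡ᵇ j)) (fromTo 1 (length w))
Yj j w = countB (λ i → isDesc w i ∧ (occ w (suc i) ≡ᵇ j)) (fromTo 1 (length w ∸ 1))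
Zj j w = countB (λ i → isPlat w i ∧ (occ w i ≡ᵇ j)) (fromTo 1 (length w))

-- "ts is an enumeration (without repetition) of the set of all x with P x".
-- The expectation of a statistic f under the uniform distribution on that
-- set equals  sum (map f ts) / length ts.

Enumerates : {A : Set} → (A → Set) → List A → Set
Enumerates P xs = Unique xs × (∀ x → (x ∈ xs) ⇔ P x)

module Submission where

open import Data.Nat using (ℕ; zero; suc; _+_; _*_; _∸_; _≤_; _<_; _<ᵇ_; _≤ᵇ_; _≡ᵇ_; s≤s; s≤s⁻¹; z≤n; s<s; z<s; _≤?_; _<?_)
open import Data.Nat.Properties
open import Data.Nat.ListAction using (sum)
open import Data.Nat.ListAction.Properties using (sum-++; sum-↭)
open import Data.Nat.Tactic.RingSolver using (solve-∀)
open import Data.Bool using (Bool; true; false; if_then_else_; _∧_; _∨_; not)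
open import Data.Bool.Properties using (T-≡; ∧-identityʳ; ∧-zeroʳ)
open import Data.Bool.ListAction using (any)
open import Data.Fin using (Fin; toℕ) renaming (zero to fzero; suc to fsuc)
open import Data.Fin.Properties using (toℕ<n)
open import Data.List using (List; []; _∷_; _++_; _∷ʳ_; map; length; replicate; take; drop; upTo; applyUpTo; concatMap)
open import Data.List.Properties using (length-++; length-map; length-replicate; length-take; length-upTo; take++drop≡id; ++-assoc; map-++; map-∘; map-cong; map-upTo)
open import Data.List.Reverse using (Reverse; []; _∶_∶ʳ_; reverseView)
open import Data.List.Membership.Propositional using (_∈_; find; lose)
open import Data.List.Membership.Propositional.Properties using (∈-map⁺; ∈-map⁻; ∈-upTo⁺; ∈-upTo⁻; ∈-concatMap⁺; ∈-concatMap⁻)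
open import Data.List.Membership.Propositional.Properties.WithK using (unique∧set⇒bag)
open import Data.List.Relation.Unary.All as All using (All; []; _∷_)
import Data.List.Relation.Unary.All.Properties as All
open import Data.List.Relation.Unary.AllPairs using ([]; _∷_)
open import Data.List.Relation.Unary.Any using (here; there)
open import Data.List.Relation.Unary.Unique.Propositional using (Unique)
import Data.List.Relation.Unary.Unique.Propositional.Properties as Unique
open import Data.List.Relation.Binary.BagAndSetEquality using (∼bag⇒↭)
open import Data.List.Relation.Binary.Permutation.Propositional using (_↭_)
open import Data.List.Relation.Binary.Permutation.Propositional.Properties using (map⁺; ↭-length)
open import Data.Product using (_×_; _,_; proj₁; proj₂; Σ-syntax; ∃-syntax)
open import Data.Empty using (⊥; ⊥-elim)
open import Function.Bundles using (Equivalence; mk⇔)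
open import Relation.Binary.Definitions using (tri<; tri≈; tri>)
open import Relation.Binary.PropositionalEquality
open import Relation.Nullary using (¬_; contradiction; yes; no)
open import Algebra.Properties.CommutativeSemigroup +-commutativeSemigroup using (interchange; x∙yz≈y∙xz)
open import Defs

-- Exchanging the children in positions j and j' at every vertex is an
-- involution on the increasing trees of order n, so all positions have the same
-- mean number of occupied (D) and of empty (L) slots (tree-mean).  Summed over the
-- k+1 positions these numbers are n-1 and (k+1)n-(n-1) = kn+1 for every tree
-- (Dstat-total, Lstat-total); dividing by k+1 gives the means.
--
-- Each permutation of order n+1 arises exactly once by
-- inserting the block (n+1)^k into one of the kn+1 gaps of a permutation of order
-- n (stirlings-enumerate).  All six word statistics count adjacent pairs passing a
-- local test; an insertion destroys the pair at its gap and creates k+1 new pairs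
-- (gap-formula, GapEffect).  Summing over all gaps and all permutations yields a
-- linear recurrence for the totals (total-suc), solved by the claimed means
-- (mean-by-insertion).  Any other enumeration is a permutation of the generated
-- list, so it has the same totals and size (enumerations-sum).

𝟙 : Bool → ℕ
𝟙 b = if b then 1 else 0

sumBelow : (ℕ → ℕ) → ℕ → ℕ
sumBelow f zero    = 0
sumBelow f (suc n) = f 0 + sumBelow (λ i → f (suc i)) n

countBelow : (ℕ → Bool) → ℕ → ℕ
countBelow P = sumBelow (λ i → 𝟙 (P i))

sumBelow-cong : ∀ {f g : ℕ → ℕ} n → (∀ i → i < n → f i ≡ g i) → sumBelow f n ≡ sumBelow g n
sumBelow-cong zero    eq = refl
sumBelow-cong (suc n) eq = cong₂ _+_ (eq 0 z<s) (sumBelow-cong n (λ i i<n → eq (suc i) (s<s i<n)))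

sumBelow-split : ∀ (f : ℕ → ℕ) a b → sumBelow f (a + b) ≡ sumBelow f a + sumBelow (λ i → f (a + i)) b
sumBelow-split f zero    b = refl
sumBelow-split f (suc a) b =
  trans (cong (f 0 +_) (sumBelow-split (λ i → f (suc i)) a b)) (sym (+-assoc (f 0) _ _))

sumBelow-+ : ∀ (f g : ℕ → ℕ) n → sumBelow (λ i → f i + g i) n ≡ sumBelow f n + sumBelow g n
sumBelow-+ f g zero    = refl
sumBelow-+ f g (suc n) =
  trans (cong (f 0 + g 0 +_) (sumBelow-+ (λ i → f (suc i)) (λ i → g (suc i)) n)) (interchange (f 0) (g 0) _ _)

sumBelow-const : ∀ c n → sumBelow (λ _ → c) n ≡ n * c
sumBelow-const c zero    = refl
sumBelow-const c (suc n) = cong (c +_) (sumBelow-const c n)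

sumBelow-*ʳ : ∀ (f : ℕ → ℕ) c n → sumBelow (λ i → f i * c) n ≡ sumBelow f n * c
sumBelow-*ʳ f c zero    = refl
sumBelow-*ʳ f c (suc n) = trans (cong (f 0 * c +_) (sumBelow-*ʳ (λ i → f (suc i)) c n)) (sym (*-distribʳ-+ c (f 0) _))

sumBelow-zero : ∀ {f : ℕ → ℕ} n → (∀ i → i < n → f i ≡ 0) → sumBelow f n ≡ 0
sumBelow-zero n eq = trans (sumBelow-cong n eq) (trans (sumBelow-const 0 n) (*-zeroʳ n))

countBelow-all : ∀ {P : ℕ → Bool} n → (∀ i → i < n → P i ≡ true) → countBelow P n ≡ n
countBelow-all n eq = trans (sumBelow-cong n (λ i i<n → cong 𝟙 (eq i i<n))) (trans (sumBelow-const 1 n) (*-identityʳ n))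

countBelow-none : ∀ {P : ℕ → Bool} n → (∀ i → i < n → P i ≡ false) → countBelow P n ≡ 0
countBelow-none n eq = sumBelow-zero n (λ i i<n → cong 𝟙 (eq i i<n))

countBelow-singleton : ∀ q m → 1 ≤ q → q ≤ m → countBelow (λ i → q ≡ᵇ suc i) m ≡ 1
countBelow-singleton (suc zero)    (suc m) _ _ = cong suc (countBelow-none m (λ _ _ → refl))
countBelow-singleton (suc (suc q)) (suc m) _ (s≤s q<m) = countBelow-singleton (suc q) m (s≤s z≤n) q<m

countBelow-∧-const : ∀ (P : ℕ → Bool) c n → countBelow (λ i → P i ∧ c) n ≡ 𝟙 c * countBelow P n
countBelow-∧-const P true  n = trans (sumBelow-cong n (λ i _ → cong 𝟙 (∧-identityʳ (P i)))) (sym (+-identityʳ _))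
countBelow-∧-const P false n = countBelow-none n (λ i _ → ∧-zeroʳ (P i))

countBelow-not : ∀ (P : ℕ → Bool) n → countBelow (λ i → not (P i)) n + countBelow P n ≡ n
countBelow-not P zero    = refl
countBelow-not P (suc n) with P 0 | countBelow-not (λ i → P (suc i)) n
... | true  | ih = trans (+-suc _ _) (cong suc ih)
... | false | ih = cong suc ih

countBelow-∨ : ∀ (P Q : ℕ → Bool) n → (∀ i → P i ≡ true → Q i ≡ false) →
               countBelow (λ i → P i ∨ Q i) n ≡ countBelow P n + countBelow Q n
countBelow-∨ P Q zero    disjoint = refl
countBelow-∨ P Q (suc n) disjoint with P 0 in p0 | Q 0 in q0
... | true  | true  = contradiction (trans (sym q0) (disjoint 0 p0)) λ ()
... | true  | false = cong suc (countBelow-∨ (λ i → P (suc i)) (λ i → Q (suc i)) n (λ i → disjoint (suc i)))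
... | false | true  = trans (cong suc (countBelow-∨ (λ i → P (suc i)) (λ i → Q (suc i)) n (λ i → disjoint (suc i))))
                           (sym (+-suc _ _))
... | false | false = countBelow-∨ (λ i → P (suc i)) (λ i → Q (suc i)) n (λ i → disjoint (suc i))

countB-cons : ∀ {A : Set} (P : A → Bool) x xs → countB P (x ∷ xs) ≡ 𝟙 (P x) + countB P xs
countB-cons P x xs with P x
... | true  = refl
... | false = refl

countB-++ : ∀ {A : Set} (P : A → Bool) xs ys → countB P (xs ++ ys) ≡ countB P xs + countB P ys
countB-++ P []       ys = refl
countB-++ P (x ∷ xs) ys with P x
... | true  = cong suc (countB-++ P xs ys)
... | false = countB-++ P xs ys

countB-map : ∀ {A B : Set} (P : B → Bool) (f : A → B) xs → countB P (map f xs) ≡ countB (λ x → P (f x)) xs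
countB-map P f []       = refl
countB-map P f (x ∷ xs) with P (f x)
... | true  = cong suc (countB-map P f xs)
... | false = countB-map P f xs

countB-cong : ∀ {A : Set} {P Q : A → Bool} xs → (∀ {x} → x ∈ xs → P x ≡ Q x) → countB P xs ≡ countB Q xs
countB-cong []       eq = refl
countB-cong {P = P} {Q} (x ∷ xs) eq with P x | Q x | eq (here refl)
... | true  | true  | _ = cong suc (countB-cong xs (λ x∈ → eq (there x∈)))
... | false | false | _ = countB-cong xs (λ x∈ → eq (there x∈))

countB-applyUpTo : ∀ (P : ℕ → Bool) (f : ℕ → ℕ) n → countB P (applyUpTo f n) ≡ countBelow (λ i → P (f i)) n
countB-applyUpTo P f zero    = refl
countB-applyUpTo P f (suc n) with P (f 0)
... | true  = cong suc (countB-applyUpTo P (λ i → f (suc i)) n)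
... | false = countB-applyUpTo P (λ i → f (suc i)) n

countB-fromTo : ∀ (P : ℕ → Bool) lo hi → countB P (fromTo lo hi) ≡ countBelow (λ i → P (lo + i)) (suc hi ∸ lo)
countB-fromTo P lo hi = trans (countB-map P (lo +_) (upTo (suc hi ∸ lo))) (countB-applyUpTo (λ i → P (lo + i)) (λ i → i) (suc hi ∸ lo))

≡ᵇ-true : ∀ {m n} → m ≡ n → (m ≡ᵇ n) ≡ true
≡ᵇ-true {m} {n} m≡n = Equivalence.to T-≡ (≡⇒≡ᵇ m n m≡n)

≡ᵇ-false : ∀ {m n} → ¬ m ≡ n → (m ≡ᵇ n) ≡ false
≡ᵇ-false {m} {n} m≢n with m ≡ᵇ n in eq
... | true  = contradiction (≡ᵇ⇒≡ m n (Equivalence.from T-≡ eq)) m≢n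
... | false = refl

≡ᵇ-sound : ∀ m n → (m ≡ᵇ n) ≡ true → m ≡ n
≡ᵇ-sound m n eq = ≡ᵇ⇒≡ m n (Equivalence.from T-≡ eq)

≡ᵇ-comm : ∀ m n → (m ≡ᵇ n) ≡ (n ≡ᵇ m)
≡ᵇ-comm zero    zero    = refl
≡ᵇ-comm zero    (suc n) = refl
≡ᵇ-comm (suc m) zero    = refl
≡ᵇ-comm (suc m) (suc n) = ≡ᵇ-comm m n

<ᵇ-true : ∀ {m n} → m < n → (m <ᵇ n) ≡ true
<ᵇ-true m<n = Equivalence.to T-≡ (<⇒<ᵇ m<n)

<ᵇ-false : ∀ {m n} → n ≤ m → (m <ᵇ n) ≡ false
<ᵇ-false {m} {n} n≤m with m <ᵇ n in eq
... | true  = ⊥-elim (<⇒≱ (<ᵇ⇒< m n (Equivalence.from T-≡ eq)) n≤m)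
... | false = refl

<ᵇ-irreflexive : ∀ a → (a <ᵇ a) ≡ false
<ᵇ-irreflexive a = <ᵇ-false (≤-refl {a})

∧-elimˡ : ∀ {x y} → (x ∧ y) ≡ true → x ≡ true
∧-elimˡ {true} _ = refl

∧-elimʳ : ∀ {x y} → (x ∧ y) ≡ true → y ≡ true
∧-elimʳ {true} y≡true = y≡true

sum-map-cong : ∀ {A : Set} (f g : A → ℕ) xs → (∀ {x} → x ∈ xs → f x ≡ g x) → sum (map f xs) ≡ sum (map g xs)
sum-map-cong f g []       eq = refl
sum-map-cong f g (x ∷ xs) eq = cong₂ _+_ (eq (here refl)) (sum-map-cong f g xs (λ x∈ → eq (there x∈)))

sum-map-const : ∀ {A : Set} c (xs : List A) → sum (map (λ _ → c) xs) ≡ c * length xs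
sum-map-const c []       = sym (*-zeroʳ c)
sum-map-const c (x ∷ xs) = trans (cong (c +_) (sum-map-const c xs)) (sym (*-suc c (length xs)))

sumBelow-sum : ∀ {A : Set} (F : ℕ → A → ℕ) m xs →
               sumBelow (λ a → sum (map (F a) xs)) m ≡ sum (map (λ x → sumBelow (λ a → F a x) m) xs)
sumBelow-sum F m []       = trans (sumBelow-const 0 m) (*-zeroʳ m)
sumBelow-sum F m (x ∷ xs) =
  trans (sumBelow-+ (λ a → F a x) (λ a → sum (map (F a) xs)) m) (cong (sumBelow (λ a → F a x) m +_) (sumBelow-sum F m xs))

module _ {A : Set} {P : A → Set} {xs ys : List A} (enum-xs : Enumerates P xs) (enum-ys : Enumerates P ys) where

  enumerations-↭ : xs ↭ ys
  enumerations-↭ = ∼bag⇒↭ (unique∧set⇒bag (proj₁ enum-xs) (proj₁ enum-ys) (λ {z} →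
    mk⇔ (λ z∈xs → Equivalence.from (proj₂ enum-ys z) (Equivalence.to (proj₂ enum-xs z) z∈xs))
        (λ z∈ys → Equivalence.from (proj₂ enum-xs z) (Equivalence.to (proj₂ enum-ys z) z∈ys))))

  enumerations-sum : (f : A → ℕ) → sum (map f xs) ≡ sum (map f ys)
  enumerations-sum f = sum-↭ (map⁺ f enumerations-↭)

  enumerations-length : length xs ≡ length ys
  enumerations-length = ↭-length enumerations-↭

mean-by-symmetry : ∀ {A : Set} (F : ℕ → A → ℕ) (xs : List A) k j c →
  (∀ a → a < suc k → sum (map (F (suc a)) xs) ≡ sum (map (F j) xs)) →
  (∀ {x} → x ∈ xs → sumBelow (λ a → F (suc a) x) (suc k) ≡ c) →
  suc k * sum (map (F j) xs) ≡ c * length xs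
mean-by-symmetry F xs k j c same-total constant-sum = begin
  suc k * sum (map (F j) xs)                            ≡⟨ sumBelow-const _ (suc k) ⟨
  sumBelow (λ _ → sum (map (F j) xs)) (suc k)           ≡⟨ sumBelow-cong (suc k) (λ a a≤k → sym (same-total a a≤k)) ⟩
  sumBelow (λ a → sum (map (F (suc a)) xs)) (suc k)     ≡⟨ sumBelow-sum (λ a → F (suc a)) (suc k) xs ⟩
  sum (map (λ x → sumBelow (λ a → F (suc a) x) (suc k)) xs) ≡⟨ sum-map-cong _ _ xs constant-sum ⟩
  sum (map (λ _ → c) xs)                                ≡⟨ sum-map-const c xs ⟩
  c * length xs                                         ∎
  where open ≡-Reasoning

involution-injective : ∀ {A : Set} (f : A → A) → (∀ x → f (f x) ≡ x) → ∀ {x y} → f x ≡ f y → x ≡ y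
involution-injective f f-involutive {x} {y} fx≡fy =
  trans (sym (f-involutive x)) (trans (cong f fx≡fy) (f-involutive y))

module _ {A : Set} {P : A → Set} (f : A → A) (f-involutive : ∀ x → f (f x) ≡ x)
         (f-preserves : ∀ {x} → P x → P (f x)) where

  involution-enumerates : ∀ {xs} → Enumerates P xs → Enumerates P (map f xs)
  involution-enumerates (unique , members) =
    Unique.map⁺ (involution-injective f f-involutive) unique ,
    λ y → mk⇔ (λ y∈ → let (x , x∈ , y≡fx) = ∈-map⁻ f y∈ in subst P (sym y≡fx) (f-preserves (Equivalence.to (members x) x∈)))
              (λ Py → subst (_∈ map f _) (f-involutive y) (∈-map⁺ f (Equivalence.from (members (f y)) (f-preserves Py))))

  sum-involution-invariant : ∀ {xs} → Enumerates P xs → (F : A → ℕ) → sum (map F xs) ≡ sum (map (λ x → F (f x)) xs)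
  sum-involution-invariant {xs} enum F =
    trans (enumerations-sum enum (involution-enumerates enum) F) (cong sum (sym (map-∘ xs)))

transpose : ℕ → ℕ → ℕ → ℕ
transpose j j' q = if q ≡ᵇ j then j' else (if q ≡ᵇ j' then j else q)

transpose-≡ᵇ : ∀ j j' q → (transpose j j' q ≡ᵇ j') ≡ (q ≡ᵇ j)
transpose-≡ᵇ j j' q with q ≟ j
... | yes refl rewrite ≡ᵇ-true (refl {x = q}) = ≡ᵇ-true (refl {x = j'})
... | no q≢j with q ≟ j'
...   | yes refl rewrite ≡ᵇ-false q≢j | ≡ᵇ-true (refl {x = q}) = ≡ᵇ-false (λ j≡q → q≢j (sym j≡q))
...   | no q≢j' rewrite ≡ᵇ-false q≢j | ≡ᵇ-false q≢j' = ≡ᵇ-false q≢j'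

transpose-involutive : ∀ j j' q → transpose j j' (transpose j j' q) ≡ q
transpose-involutive j j' q with q ≟ j
... | yes refl rewrite ≡ᵇ-true (refl {x = q}) with j' ≟ q
...   | yes refl rewrite ≡ᵇ-true (refl {x = j'}) = refl
...   | no j'≢q rewrite ≡ᵇ-false j'≢q | ≡ᵇ-true (refl {x = j'}) = refl
transpose-involutive j j' q | no q≢j with q ≟ j'
...   | yes refl rewrite ≡ᵇ-false q≢j | ≡ᵇ-true (refl {x = q}) | ≡ᵇ-true (refl {x = j}) = refl
...   | no q≢j' rewrite ≡ᵇ-false q≢j | ≡ᵇ-false q≢j' | ≡ᵇ-false q≢j | ≡ᵇ-false q≢j' = refl

transpose-range : ∀ {b j j' q} → 1 ≤ j → j ≤ b → 1 ≤ j' → j' ≤ b → 1 ≤ q → q ≤ b →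
                  (1 ≤ transpose j j' q) × (transpose j j' q ≤ b)
transpose-range {b} {j} {j'} {q} 1≤j j≤b 1≤j' j'≤b 1≤q q≤b with q ≡ᵇ j
... | true = 1≤j' , j'≤b
... | false with q ≡ᵇ j'
...   | true  = 1≤j , j≤b
...   | false = 1≤q , q≤b

swapEdge : ℕ → ℕ → ℕ × ℕ → ℕ × ℕ
swapEdge j j' e = proj₁ e , transpose j j' (proj₂ e)

swapPositions : ℕ → ℕ → List (ℕ × ℕ) → List (ℕ × ℕ)
swapPositions j j' = map (swapEdge j j')

swapPositions-involutive : ∀ j j' t → swapPositions j j' (swapPositions j j' t) ≡ t
swapPositions-involutive j j' []            = refl
swapPositions-involutive j j' ((p , q) ∷ t) =
  cong₂ _∷_ (cong (p ,_) (transpose-involutive j j' q)) (swapPositions-involutive j j' t)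

lookup-map : ∀ {A B : Set} (f : A → B) (xs : List A) (m : Fin (length (map f xs))) →
  Σ[ m' ∈ Fin (length xs) ] (toℕ m' ≡ toℕ m) × (Data.List.lookup (map f xs) m ≡ f (Data.List.lookup xs m'))
lookup-map f (x ∷ xs) fzero    = fzero , refl , refl
lookup-map f (x ∷ xs) (fsuc m) = let (m' , same-index , same-entry) = lookup-map f xs m in
  fsuc m' , cong suc same-index , same-entry

swapPositions-isIncTree : ∀ {k n j j'} t → 1 ≤ j → j ≤ suc k → 1 ≤ j' → j' ≤ suc k →
                          IsIncTree k n t → IsIncTree k n (swapPositions j j' t)
swapPositions-isIncTree {k} {n} {j} {j'} t 1≤j j≤k+1 1≤j' j'≤k+1 (size , bounds , unique) =
  trans (length-map (swapEdge j j') t) size , bounds′ ,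
  Unique.map⁺ (involution-injective (swapEdge j j') edge-involutive) unique
  where
    edge-involutive : ∀ e → swapEdge j j' (swapEdge j j' e) ≡ e
    edge-involutive (p , q) = cong (p ,_) (transpose-involutive j j' q)
    bounds′ : (m : Fin (length (swapPositions j j' t))) → let e = Data.List.lookup (swapPositions j j' t) m in
              (1 ≤ proj₁ e) × (proj₁ e ≤ suc (toℕ m)) × (1 ≤ proj₂ e) × (proj₂ e ≤ suc k)
    bounds′ m with lookup-map (swapEdge j j') t m
    ... | m' , same-index , same-entry rewrite same-entry with bounds m'
    ...   | 1≤p , p≤m'+1 , 1≤q , q≤k+1 =
      1≤p , subst (λ i → _ ≤ suc i) same-index p≤m'+1 , transpose-range 1≤j j≤k+1 1≤j' j'≤k+1 1≤q q≤k+1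

Dstat-swap : ∀ j j' t → Dstat j' (swapPositions j j' t) ≡ Dstat j t
Dstat-swap j j' t = trans (countB-map (λ e → proj₂ e ≡ᵇ j') (swapEdge j j') t)
                          (countB-cong t (λ {e} _ → transpose-≡ᵇ j j' (proj₂ e)))

occupied : List (ℕ × ℕ) → ℕ → ℕ → Bool
occupied t v j = any (λ e → (proj₁ e ≡ᵇ v) ∧ (proj₂ e ≡ᵇ j)) t

Lstat-swap : ∀ n j j' t → Lstat n j' (swapPositions j j' t) ≡ Lstat n j t
Lstat-swap n j j' t = countB-cong (fromTo 1 n) (λ {v} _ → cong not (occupied-swap v t))
  where
    occupied-swap : ∀ v t → occupied (swapPositions j j' t) v j' ≡ occupied t v j
    occupied-swap v []      = refl
    occupied-swap v (e ∷ t) = cong₂ _∨_ (cong ((proj₁ e ≡ᵇ v) ∧_) (transpose-≡ᵇ j j' (proj₂ e))) (occupied-swap v t)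

occupied-sound : ∀ v j t → occupied t v j ≡ true → (v , j) ∈ t
occupied-sound v j ((p , q) ∷ t) occ with p ≟ v | q ≟ j
... | yes refl | yes refl = here refl
... | yes refl | no q≢j rewrite ≡ᵇ-false q≢j | ≡ᵇ-true (refl {x = p}) = there (occupied-sound v j t occ)
... | no p≢v   | _       rewrite ≡ᵇ-false p≢v = there (occupied-sound v j t occ)

EdgeInRange : ℕ → ℕ → ℕ × ℕ → Set
EdgeInRange k n e = (1 ≤ proj₁ e) × (proj₁ e ≤ n) × (1 ≤ proj₂ e) × (proj₂ e ≤ suc k)

edges-in-range : ∀ {k n} t → IsIncTree k n t → All (EdgeInRange k n) t
edges-in-range {k} {n} t (size , bounds , _) = tabulate t (λ m → let (1≤p , p≤m+1 , q-range) = bounds m in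
  1≤p , ≤-trans p≤m+1 (≤-trans (toℕ<n m) (≤-trans (≤-reflexive size) (m∸n≤m n 1))) , q-range)
  where
    tabulate : ∀ t → ((m : Fin (length t)) → EdgeInRange k n (Data.List.lookup t m)) → All (EdgeInRange k n) t
    tabulate []      h = []
    tabulate (e ∷ t) h = h fzero ∷ tabulate t (λ m → h (fsuc m))

-- Each vertex other than the root occupies exactly one position of its parent:
-- D_{n,1} + ... + D_{n,k+1} = n - 1.
Dstat-total : ∀ {k n} t → All (EdgeInRange k n) t → sumBelow (λ a → Dstat (suc a) t) (suc k) ≡ length t
Dstat-total {k} [] [] = sumBelow-zero (suc k) (λ _ _ → refl)
Dstat-total {k} ((p , q) ∷ t) ((_ , _ , 1≤q , q≤k+1) ∷ in-range) = begin
  sumBelow (λ a → Dstat (suc a) ((p , q) ∷ t)) (suc k)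
    ≡⟨ sumBelow-cong (suc k) (λ a _ → countB-cons (λ e → proj₂ e ≡ᵇ suc a) (p , q) t) ⟩
  sumBelow (λ a → 𝟙 (q ≡ᵇ suc a) + Dstat (suc a) t) (suc k)
    ≡⟨ sumBelow-+ (λ a → 𝟙 (q ≡ᵇ suc a)) (λ a → Dstat (suc a) t) (suc k) ⟩
  countBelow (λ a → q ≡ᵇ suc a) (suc k) + sumBelow (λ a → Dstat (suc a) t) (suc k)
    ≡⟨ cong₂ _+_ (countBelow-singleton q (suc k) 1≤q q≤k+1) (Dstat-total t in-range) ⟩
  suc (length t) ∎
  where open ≡-Reasoning

occupied-total : ∀ {k n} t → All (EdgeInRange k n) t → Unique t →
  sumBelow (λ a → countBelow (λ i → occupied t (suc i) (suc a)) n) (suc k) ≡ length t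
occupied-total {k} {n} [] [] [] = sumBelow-zero (suc k) (λ a _ → countBelow-none n (λ _ _ → refl))
occupied-total {k} {n} ((p , q) ∷ t) ((1≤p , p≤n , 1≤q , q≤k+1) ∷ in-range) (fresh ∷ unique) = begin
  sumBelow (λ a → countBelow (λ i → isEdge i a ∨ occupied t (suc i) (suc a)) n) (suc k)
    ≡⟨ sumBelow-cong {g = λ a → inHead a + inTail a} (suc k)
         (λ a _ → countBelow-∨ (λ i → isEdge i a) (λ i → occupied t (suc i) (suc a)) n (λ i → not-in-rest i a)) ⟩
  sumBelow (λ a → inHead a + inTail a) (suc k)
    ≡⟨ sumBelow-+ inHead inTail (suc k) ⟩
  sumBelow inHead (suc k) + sumBelow inTail (suc k)
    ≡⟨ cong₂ _+_ this-edge (occupied-total t in-range unique) ⟩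
  suc (length t) ∎
  where
    open ≡-Reasoning
    isEdge : ℕ → ℕ → Bool
    isEdge i a = (p ≡ᵇ suc i) ∧ (q ≡ᵇ suc a)
    inHead inTail : ℕ → ℕ
    inHead a = countBelow (λ i → isEdge i a) n
    inTail a = countBelow (λ i → occupied t (suc i) (suc a)) n
    this-edge : sumBelow inHead (suc k) ≡ 1
    this-edge = begin
      sumBelow inHead (suc k)
        ≡⟨ sumBelow-cong {g = λ a → 𝟙 (q ≡ᵇ suc a)} (suc k) (λ a _ → begin
             inHead a                                               ≡⟨ countBelow-∧-const (λ i → p ≡ᵇ suc i) (q ≡ᵇ suc a) n ⟩
             𝟙 (q ≡ᵇ suc a) * countBelow (λ i → p ≡ᵇ suc i) n    ≡⟨ cong (𝟙 (q ≡ᵇ suc a) *_) (countBelow-singleton p n 1≤p p≤n) ⟩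
             𝟙 (q ≡ᵇ suc a) * 1                                     ≡⟨ *-identityʳ _ ⟩
             𝟙 (q ≡ᵇ suc a)                                         ∎) ⟩
      countBelow (λ a → q ≡ᵇ suc a) (suc k)
        ≡⟨ countBelow-singleton q (suc k) 1≤q q≤k+1 ⟩
      1 ∎
    not-in-rest : ∀ i a → isEdge i a ≡ true → occupied t (suc i) (suc a) ≡ false
    not-in-rest i a edge with occupied t (suc i) (suc a) in occ
    ... | false = refl
    ... | true with ≡ᵇ-sound p (suc i) (∧-elimˡ edge) | ≡ᵇ-sound q (suc a) (∧-elimʳ edge)
    ...   | refl | refl = ⊥-elim (All.lookup fresh (occupied-sound (suc i) (suc a) t occ) refl)

-- Every vertex has k+1 positions and n-1 of the (k+1)n positions are occupied:
-- L_{n,1} + ... + L_{n,k+1} = kn + 1.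
Lstat-total : ∀ {k n} t → 1 ≤ n → IsIncTree k n t → sumBelow (λ a → Lstat n (suc a) t) (suc k) ≡ k * n + 1
Lstat-total {k} {suc n} t _ tree@(size , _ , unique) = +-cancelʳ-≡ n _ _ (begin
  sumBelow (λ a → Lstat (suc n) (suc a) t) (suc k) + n
    ≡⟨ cong₂ _+_ (sumBelow-cong {f = λ a → Lstat (suc n) (suc a) t} (suc k) (λ a _ → Lstat-vacant a))
                 (sym (trans (occupied-total t (edges-in-range t tree) unique) size)) ⟩
  sumBelow vacant (suc k) + sumBelow filled (suc k)
    ≡⟨ sumBelow-+ vacant filled (suc k) ⟨
  sumBelow (λ a → vacant a + filled a) (suc k)
    ≡⟨ sumBelow-cong (suc k) (λ a _ → countBelow-not (λ i → occupied t (suc i) (suc a)) (suc n)) ⟩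
  sumBelow (λ _ → suc n) (suc k)
    ≡⟨ sumBelow-const (suc n) (suc k) ⟩
  suc k * suc n
    ≡⟨ rearrange k n ⟩
  k * suc n + 1 + n ∎)
  where
    open ≡-Reasoning
    rearrange : ∀ k n → suc k * suc n ≡ k * suc n + 1 + n
    rearrange = solve-∀
    vacant filled : ℕ → ℕ
    vacant a = countBelow (λ i → not (occupied t (suc i) (suc a))) (suc n)
    filled a = countBelow (λ i → occupied t (suc i) (suc a)) (suc n)
    Lstat-vacant : ∀ a → Lstat (suc n) (suc a) t ≡ vacant a
    Lstat-vacant a = countB-fromTo (λ v → not (occupied t v (suc a))) 1 (suc n)

tree-mean : ∀ {k n} c (F : ℕ → List (ℕ × ℕ) → ℕ) →
  (∀ j j' t → F j' (swapPositions j j' t) ≡ F j t) →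
  (∀ t → IsIncTree k n t → sumBelow (λ a → F (suc a) t) (suc k) ≡ c) →
  ∀ ts → Enumerates (IsIncTree k n) ts →
  ∀ j → 1 ≤ j → j ≤ suc k → suc k * sum (map (F j) ts) ≡ c * length ts
tree-mean {k} {n} c F equivariant total ts enum j 1≤j j≤k+1 =
  mean-by-symmetry F ts k j c same-total (λ {t} t∈ → total t (Equivalence.to (proj₂ enum t) t∈))
  where
    same-total : ∀ a → a < suc k → sum (map (F (suc a)) ts) ≡ sum (map (F j) ts)
    same-total a a<k+1 =
      trans (sum-involution-invariant (swapPositions j (suc a)) (swapPositions-involutive j (suc a))
               (swapPositions-isIncTree {n = n} _ 1≤j j≤k+1 (s≤s z≤n) a<k+1) enum (F (suc a)))
            (cong sum (map-cong (λ t → equivariant j (suc a) t) ts))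

at-zero : ∀ w → at w 0 ≡ 0
at-zero []      = refl
at-zero (x ∷ w) = refl

at-++ˡ : ∀ u v i → i ≤ length u → at (u ++ v) i ≡ at u i
at-++ˡ []      v zero          _         = at-zero v
at-++ˡ (x ∷ u) v zero          _         = refl
at-++ˡ (x ∷ u) v (suc zero)    _         = refl
at-++ˡ (x ∷ u) v (suc (suc i)) (s≤s i≤u) = at-++ˡ u v (suc i) i≤u

at-++ʳ : ∀ u v i → at (u ++ v) (length u + suc i) ≡ at v (suc i)
at-++ʳ []      v i = refl
at-++ʳ (x ∷ u) v i rewrite +-suc (length u) i = trans (cong (at (u ++ v)) (sym (+-suc (length u) i))) (at-++ʳ u v i)

at-replicate : ∀ k N b → b < k → at (replicate k N) (suc b) ≡ N
at-replicate (suc k) N zero    _         = refl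
at-replicate (suc k) N (suc b) (s≤s b<k) = at-replicate k N b b<k

at-All : ∀ {P : ℕ → Set} w → All P w → P 0 → ∀ i → P (at w i)
at-All []      _        P0 zero          = P0
at-All []      _        P0 (suc i)       = P0
at-All (x ∷ w) _        P0 zero          = P0
at-All (x ∷ w) (Px ∷ _) P0 (suc zero)    = Px
at-All (x ∷ w) (_ ∷ Pw) P0 (suc (suc i)) = at-All w Pw P0 (suc i)

at-All-inside : ∀ {P : ℕ → Set} w → All P w → ∀ i → 1 ≤ i → i ≤ length w → P (at w i)
at-All-inside (x ∷ w) (Px ∷ _)  (suc zero)    _ _             = Px
at-All-inside (x ∷ w) (_ ∷ Pw)  (suc (suc i)) _ (s≤s i<|w|)   = at-All-inside w Pw (suc i) (s≤s z≤n) i<|w|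

at-beyond : ∀ w i → length w < i → at w i ≡ 0
at-beyond []      zero          _             = refl
at-beyond []      (suc i)       _             = refl
at-beyond (x ∷ w) (suc (suc i)) (s≤s |w|<i+1) = at-beyond w (suc i) |w|<i+1

prefixCount : List ℕ → ℕ → ℕ → ℕ
prefixCount w x i = countBelow (λ m → at w (suc m) ≡ᵇ x) i

occ-prefixCount : ∀ w i → occ w i ≡ prefixCount w (at w i) i
occ-prefixCount w i = countB-fromTo (λ m → at w m ≡ᵇ at w i) 1 i

prefixCount-++ˡ : ∀ u v x i → i ≤ length u → prefixCount (u ++ v) x i ≡ prefixCount u x i
prefixCount-++ˡ u v x i i≤u = sumBelow-cong i (λ m m<i → cong (λ a → 𝟙 (a ≡ᵇ x)) (at-++ˡ u v (suc m) (≤-trans m<i i≤u)))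

prefixCount-++ : ∀ u v x b → prefixCount (u ++ v) x (length u + b) ≡ prefixCount u x (length u) + prefixCount v x b
prefixCount-++ u v x b = trans (sumBelow-split _ (length u) b)
  (cong₂ _+_ (prefixCount-++ˡ u v x (length u) ≤-refl)
             (sumBelow-cong b (λ m _ → cong (λ a → 𝟙 (a ≡ᵇ x))
                (trans (cong (at (u ++ v)) (sym (+-suc (length u) m))) (at-++ʳ u v m)))))

prefixCount-absent : ∀ w x i → All (λ a → ¬ a ≡ x) w → 1 ≤ x → prefixCount w x i ≡ 0
prefixCount-absent w x i x∉w 1≤x =
  countBelow-none i (λ m _ → ≡ᵇ-false (at-All {P = λ a → ¬ a ≡ x} w x∉w (<⇒≢ 1≤x) (suc m)))

prefixCount-replicate : ∀ k N x b → b ≤ k → prefixCount (replicate k N) x b ≡ b * 𝟙 (N ≡ᵇ x)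
prefixCount-replicate k N x b b≤k =
  trans (sumBelow-cong b (λ m m<b → cong (λ a → 𝟙 (a ≡ᵇ x)) (at-replicate k N m (≤-trans m<b b≤k))))
        (sumBelow-const (𝟙 (N ≡ᵇ x)) b)

StirlingPattern : List ℕ → Set
StirlingPattern w = (p q r : ℕ) → 1 ≤ p → p < q → q < r → r ≤ length w → at w p ≡ at w r → at w r ≤ at w q

-- Local statistics: a test Q a b o o' applied to each adjacent pair
-- (a_i , a_{i+1}), i = 0 .. |w|, where o and o' are the occurrence numbers of
-- a_i and a_{i+1}.  All six word statistics of the theorem are of this form.
LocalTest : Set
LocalTest = ℕ → ℕ → ℕ → ℕ → Bool

localAt : LocalTest → List ℕ → ℕ → Bool
localAt Q w i = Q (at w i) (at w (suc i)) (occ w i) (occ w (suc i))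

localCount : LocalTest → List ℕ → ℕ
localCount Q w = countBelow (localAt Q w) (suc (length w))

localAt-cong : ∀ Q w i {a b o o'} → at w i ≡ a → at w (suc i) ≡ b → occ w i ≡ o → occ w (suc i) ≡ o' →
               localAt Q w i ≡ Q a b o o'
localAt-cong Q w i refl refl refl refl = refl

countBelow-gap : ∀ (P : ℕ → Bool) g V →
  countBelow P (suc (g + V)) ≡ countBelow P g + (𝟙 (P g) + countBelow (λ i → P (g + suc i)) V)
countBelow-gap P g V = trans (cong (countBelow P) (sym (+-suc g V))) (trans (sumBelow-split _ g (suc V))
  (cong (λ x → countBelow P g + (𝟙 (P x) + countBelow (λ i → P (g + suc i)) V)) (+-identityʳ g)))

countBelow-block : ∀ (P : ℕ → Bool) g k' V →
  countBelow P (suc (g + (suc k' + V))) ≡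
  countBelow P g + (𝟙 (P (g + 0)) + (countBelow (λ i → P (g + suc i)) k' +
    (𝟙 (P (g + suc (k' + 0))) + countBelow (λ i → P (g + suc (k' + suc i))) V)))
countBelow-block P g k' V = trans (cong (countBelow P) (sym (+-suc g (suc k' + V)))) (trans (sumBelow-split _ g (suc (suc k' + V)))
  (cong (λ c → countBelow P g + (𝟙 (P (g + 0)) + c))
    (trans (cong (countBelow (λ i → P (g + suc i))) (sym (+-suc k' V))) (sumBelow-split _ k' (suc V)))))

-- When the block N^k (k = k'+1) is inserted into the gap g of w, the pair
-- (a_g , a_{g+1}) is replaced by the k+1 pairs (a_g , N), (N , N) (k-1 times,
-- with occurrence numbers i+1 and i+2) and (N , a_{g+1}); newPairs counts
-- those among them that pass the test Q.
newPairs : ℕ → ℕ → List ℕ → ℕ → LocalTest → ℕ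
newPairs k' N w g Q = 𝟙 (Q (at w g) N (occ w g) 1) +
  (countBelow (λ i → Q N N (suc i) (suc (suc i))) k' + 𝟙 (Q N (at w (suc g)) (suc k') (occ w (suc g))))

module BlockInsertion (n k' : ℕ) (u v : List ℕ) (u<N : All (_< suc n) u) (v<N : All (_< suc n) v) where
  N k g V : ℕ
  N = suc n
  k = suc k'
  g = length u
  V = length v

  block w w' : List ℕ
  block = replicate k N
  w     = u ++ v
  w'    = u ++ (block ++ v)

  length-block : length block ≡ k
  length-block = length-replicate k

  length-w : length w ≡ g + V
  length-w = length-++ u

  length-w' : length w' ≡ g + (k + V)
  length-w' = trans (length-++ u) (cong (g +_) (trans (length-++ block) (cong (_+ V) length-block)))

  letter-left : ∀ i → i ≤ g → at w' i ≡ at w i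
  letter-left i i≤g = trans (at-++ˡ u (block ++ v) i i≤g) (sym (at-++ˡ u v i i≤g))

  letter-block : ∀ b → b < k → at w' (g + suc b) ≡ N
  letter-block b b<k = trans (at-++ʳ u (block ++ v) b)
    (trans (at-++ˡ block v (suc b) (subst (suc b ≤_) (sym length-block) b<k)) (at-replicate k N b b<k))

  letter-right : ∀ m → at w' (g + (k + suc m)) ≡ at w (g + suc m)
  letter-right m = begin
    at w' (g + (k + suc m))             ≡⟨ at-++ʳ u (block ++ v) (k' + suc m) ⟩
    at (block ++ v) (k + suc m)         ≡⟨ cong (λ l → at (block ++ v) (l + suc m)) (sym length-block) ⟩
    at (block ++ v) (length block + suc m) ≡⟨ at-++ʳ block v m ⟩
    at v (suc m)                        ≡⟨ at-++ʳ u v m ⟨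
    at w (g + suc m)                    ∎
    where open ≡-Reasoning

  occ-left : ∀ i → i ≤ g → occ w' i ≡ occ w i
  occ-left i i≤g = begin
    occ w' i                         ≡⟨ occ-prefixCount w' i ⟩
    prefixCount w' (at w' i) i       ≡⟨ cong (λ a → prefixCount w' a i) (letter-left i i≤g) ⟩
    prefixCount w' (at w i) i        ≡⟨ prefixCount-++ˡ u (block ++ v) _ i i≤g ⟩
    prefixCount u (at w i) i         ≡⟨ prefixCount-++ˡ u v _ i i≤g ⟨
    prefixCount w (at w i) i         ≡⟨ occ-prefixCount w i ⟨
    occ w i                          ∎
    where open ≡-Reasoning

  occ-block : ∀ b → b < k → occ w' (g + suc b) ≡ suc b
  occ-block b b<k = begin
    occ w' (g + suc b)                                     ≡⟨ occ-prefixCount w' (g + suc b) ⟩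
    prefixCount w' (at w' (g + suc b)) (g + suc b)         ≡⟨ cong (λ a → prefixCount w' a (g + suc b)) (letter-block b b<k) ⟩
    prefixCount w' N (g + suc b)                           ≡⟨ prefixCount-++ u (block ++ v) N (suc b) ⟩
    prefixCount u N g + prefixCount (block ++ v) N (suc b) ≡⟨ cong₂ _+_ (prefixCount-absent u N g (All.map <⇒≢ u<N) (s≤s z≤n))
                                                                         (prefixCount-++ˡ block v N (suc b) b+1≤|block|) ⟩
    prefixCount block N (suc b)                            ≡⟨ prefixCount-replicate k N N (suc b) b<k ⟩
    suc b * 𝟙 (N ≡ᵇ N)                                     ≡⟨ cong (λ c → suc b * 𝟙 c) (≡ᵇ-true (refl {x = N})) ⟩
    suc b * 1                                              ≡⟨ *-identityʳ (suc b) ⟩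
    suc b                                                  ∎
    where
      open ≡-Reasoning
      b+1≤|block| : suc b ≤ length block
      b+1≤|block| = subst (suc b ≤_) (sym length-block) b<k

  occ-right : ∀ m → occ w' (g + (k + suc m)) ≡ occ w (g + suc m)
  occ-right m = begin
    occ w' (g + (k + suc m))                                    ≡⟨ occ-prefixCount w' (g + (k + suc m)) ⟩
    prefixCount w' (at w' (g + (k + suc m))) (g + (k + suc m))  ≡⟨ cong (λ a → prefixCount w' a (g + (k + suc m))) (trans (letter-right m) x-here) ⟩
    prefixCount w' x (g + (k + suc m))                          ≡⟨ prefixCount-++ u (block ++ v) x (k + suc m) ⟩
    prefixCount u x g + prefixCount (block ++ v) x (k + suc m)  ≡⟨ cong (λ l → prefixCount u x g + prefixCount (block ++ v) x (l + suc m)) (sym length-block) ⟩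
    prefixCount u x g + prefixCount (block ++ v) x (length block + suc m)
      ≡⟨ cong (prefixCount u x g +_) (prefixCount-++ block v x (suc m)) ⟩
    prefixCount u x g + (prefixCount block x (length block) + prefixCount v x (suc m))
      ≡⟨ cong (λ c → prefixCount u x g + (c + prefixCount v x (suc m))) no-x-in-block ⟩
    prefixCount u x g + prefixCount v x (suc m)                 ≡⟨ prefixCount-++ u v x (suc m) ⟨
    prefixCount w x (g + suc m)                                 ≡⟨ cong (λ a → prefixCount w a (g + suc m)) x-here ⟨
    prefixCount w (at w (g + suc m)) (g + suc m)                ≡⟨ occ-prefixCount w (g + suc m) ⟨
    occ w (g + suc m)                                           ∎
    where
      open ≡-Reasoning
      x : ℕ
      x = at v (suc m)
      x-here : at w (g + suc m) ≡ x
      x-here = at-++ʳ u v m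
      no-x-in-block : prefixCount block x (length block) ≡ 0
      no-x-in-block = trans (prefixCount-replicate k N x (length block) (≤-reflexive length-block))
        (trans (cong (λ c → length block * 𝟙 c) (≡ᵇ-false (λ N≡x → <⇒≢ (at-All {P = _< N} v v<N z<s (suc m)) (sym N≡x))))
               (*-zeroʳ (length block)))

  private
    next : ∀ b → suc (g + b) ≡ g + suc b
    next b = sym (+-suc g b)

    local-left : ∀ Q i → i < g → localAt Q w' i ≡ localAt Q w i
    local-left Q i i<g = localAt-cong Q w' i (letter-left i (<⇒≤ i<g)) (letter-left (suc i) i<g)
                                             (occ-left i (<⇒≤ i<g)) (occ-left (suc i) i<g)

    local-enter : ∀ Q → localAt Q w' (g + 0) ≡ Q (at w g) N (occ w g) 1
    local-enter Q = localAt-cong Q w' (g + 0)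
      (trans (cong (at w') (+-identityʳ g)) (letter-left g ≤-refl)) (trans (cong (at w') (next 0)) (letter-block 0 z<s))
      (trans (cong (occ w') (+-identityʳ g)) (occ-left g ≤-refl))   (trans (cong (occ w') (next 0)) (occ-block 0 z<s))

    local-inside : ∀ Q i → i < k' → localAt Q w' (g + suc i) ≡ Q N N (suc i) (suc (suc i))
    local-inside Q i i<k' = localAt-cong Q w' (g + suc i)
      (letter-block i (m≤n⇒m≤1+n i<k')) (trans (cong (at w') (next (suc i))) (letter-block (suc i) (s≤s i<k')))
      (occ-block i (m≤n⇒m≤1+n i<k'))    (trans (cong (occ w') (next (suc i))) (occ-block (suc i) (s≤s i<k')))

    local-exit : ∀ Q → localAt Q w' (g + suc (k' + 0)) ≡ Q N (at w (suc g)) k (occ w (suc g))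
    local-exit Q = localAt-cong Q w' (g + suc (k' + 0))
      (trans (cong (λ b → at w' (g + suc b)) (+-identityʳ k')) (letter-block k' ≤-refl))
      (trans (cong (at w') after-block) (trans (letter-right 0) (cong (at w) g+1)))
      (trans (cong (λ b → occ w' (g + suc b)) (+-identityʳ k')) (occ-block k' ≤-refl))
      (trans (cong (occ w') after-block) (trans (occ-right 0) (cong (occ w) g+1)))
      where
        after-block : suc (g + suc (k' + 0)) ≡ g + (k + suc 0)
        after-block = trans (next (suc (k' + 0))) (cong (λ b → g + suc b) (sym (+-suc k' 0)))
        g+1 : g + suc 0 ≡ suc g
        g+1 = trans (+-suc g 0) (cong suc (+-identityʳ g))

    local-right : ∀ Q i → localAt Q w' (g + suc (k' + suc i)) ≡ localAt Q w (g + suc i)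
    local-right Q i = localAt-cong Q w' _ (letter-right i)
      (trans (cong (at w') shifted) (trans (letter-right (suc i)) (cong (at w) (sym (next (suc i))))))
      (occ-right i)
      (trans (cong (occ w') shifted) (trans (occ-right (suc i)) (cong (occ w) (sym (next (suc i))))))
      where
        shifted : suc (g + suc (k' + suc i)) ≡ g + (k + suc (suc i))
        shifted = trans (next _) (cong (λ b → g + suc b) (sym (+-suc k' (suc i))))

  gap-formula : ∀ Q → localCount Q w' + 𝟙 (localAt Q w g) ≡ localCount Q w + newPairs k' N w g Q
  gap-formula Q = begin
    localCount Q w' + 𝟙 (P g)
      ≡⟨ cong (λ l → countBelow P' (suc l) + 𝟙 (P g)) length-w' ⟩
    countBelow P' (suc (g + (k + V))) + 𝟙 (P g)
      ≡⟨ cong (_+ 𝟙 (P g)) (countBelow-block P' g k' V) ⟩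
    countBelow P' g + (𝟙 (P' (g + 0)) + (countBelow (λ i → P' (g + suc i)) k' +
      (𝟙 (P' (g + suc (k' + 0))) + countBelow (λ i → P' (g + suc (k' + suc i))) V))) + 𝟙 (P g)
      ≡⟨ cong₂ (λ a b → a + b + 𝟙 (P g)) (sumBelow-cong g (λ i i<g → cong 𝟙 (local-left Q i i<g)))
           (cong₂ _+_ (cong 𝟙 (local-enter Q)) (cong₂ _+_ (sumBelow-cong k' (λ i i<k' → cong 𝟙 (local-inside Q i i<k')))
             (cong₂ _+_ (cong 𝟙 (local-exit Q)) (sumBelow-cong V (λ i _ → cong 𝟙 (local-right Q i)))))) ⟩
    A + (Enter + (Inside + (Exit + R))) + 𝟙 (P g)
      ≡⟨ rearrange A Enter Inside Exit R (𝟙 (P g)) ⟩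
    A + (𝟙 (P g) + R) + newPairs k' N w g Q
      ≡⟨ cong (_+ newPairs k' N w g Q) (trans (cong (λ l → countBelow P (suc l)) length-w) (countBelow-gap P g V)) ⟨
    localCount Q w + newPairs k' N w g Q ∎
    where
      open ≡-Reasoning
      P P' : ℕ → Bool
      P  = localAt Q w
      P' = localAt Q w'
      A Enter Inside Exit R : ℕ
      A      = countBelow P g
      Enter  = 𝟙 (Q (at w g) N (occ w g) 1)
      Inside = countBelow (λ i → Q N N (suc i) (suc (suc i))) k'
      Exit   = 𝟙 (Q N (at w (suc g)) k (occ w (suc g)))
      R      = countBelow (λ i → P (g + suc i)) V
      rearrange : ∀ a b c d e f → a + (b + (c + (d + e))) + f ≡ a + (f + e) + (b + (c + d))
      rearrange = solve-∀

  lift : ℕ → ℕ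
  lift i with i ≤? g
  ... | yes _ = i
  ... | no  _ = k + i

  private
    beyond-gap : ∀ i → ¬ i ≤ g → g + suc (i ∸ suc g) ≡ i
    beyond-gap i i≰g = trans (+-suc g _) (m+[n∸m]≡n (≰⇒> i≰g))

  lift-letter : ∀ i → at w' (lift i) ≡ at w i
  lift-letter i with i ≤? g
  ... | yes i≤g = letter-left i i≤g
  ... | no  i≰g = begin
    at w' (k + i)                          ≡⟨ cong (λ j → at w' (k + j)) (sym (beyond-gap i i≰g)) ⟩
    at w' (k + (g + suc (i ∸ suc g)))      ≡⟨ cong (at w') (x∙yz≈y∙xz k g _) ⟩
    at w' (g + (k + suc (i ∸ suc g)))      ≡⟨ letter-right (i ∸ suc g) ⟩
    at w (g + suc (i ∸ suc g))             ≡⟨ cong (at w) (beyond-gap i i≰g) ⟩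
    at w i                                 ∎
    where open ≡-Reasoning

  lift-inflationary : ∀ i → i ≤ lift i
  lift-inflationary i with i ≤? g
  ... | yes _ = ≤-refl
  ... | no  _ = m≤n+m i k

  lift-monotone : ∀ i j → i < j → lift i < lift j
  lift-monotone i j i<j with i ≤? g | j ≤? g
  ... | yes _   | yes _   = i<j
  ... | yes _   | no  _   = <-≤-trans i<j (m≤n+m j k)
  ... | no  i≰g | yes j≤g = ⊥-elim (i≰g (≤-trans (<⇒≤ i<j) j≤g))
  ... | no  _   | no  _   = +-monoʳ-< k i<j

  lift-reflects : ∀ i j → lift i < lift j → i < j
  lift-reflects i j li<lj with <-cmp i j
  ... | tri< i<j _ _ = i<j
  ... | tri≈ _ refl _ = ⊥-elim (<-irrefl refl li<lj)
  ... | tri> _ _ j<i = ⊥-elim (<-asym li<lj (lift-monotone j i j<i))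

  lift-bounded : ∀ i → i ≤ length w → lift i ≤ length w'
  lift-bounded i i≤|w| with i ≤? g
  ... | yes _ = ≤-trans i≤|w| (subst₂ _≤_ (sym length-w) (sym length-w') (+-monoʳ-≤ g (m≤n+m V k)))
  ... | no  _ = subst (k + i ≤_) (sym length-w')
                  (≤-trans (+-monoʳ-≤ k (subst (i ≤_) length-w i≤|w|)) (≤-reflexive (x∙yz≈y∙xz k g V)))

  lift-onto : ∀ i → 1 ≤ i → i ≤ length w' → ¬ at w' i ≡ N → ∃[ i₀ ] (lift i₀ ≡ i) × (1 ≤ i₀) × (i₀ ≤ length w)
  lift-onto i 1≤i i≤|w'| not-N with i ≤? g
  ... | yes i≤g = i , lift-left , 1≤i , ≤-trans i≤g (subst (g ≤_) (sym length-w) (m≤m+n g V))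
    where
      lift-left : lift i ≡ i
      lift-left with i ≤? g
      ... | yes _   = refl
      ... | no  i≰g = ⊥-elim (i≰g i≤g)
  ... | no  i≰g = beyond (i ∸ suc g) (beyond-gap i i≰g)
    where
      beyond : ∀ d → g + suc d ≡ i → ∃[ i₀ ] (lift i₀ ≡ i) × (1 ≤ i₀) × (i₀ ≤ length w)
      beyond d i≡ with d <? k
      ... | yes d<k = ⊥-elim (not-N (trans (cong (at w') (sym i≡)) (letter-block d d<k)))
      ... | no  d≮k = i₀ , lift-i₀ , ≤-trans (s≤s z≤n) (m≤n+m (suc m) g) , i₀≤|w|
        where
          m i₀ : ℕ
          m  = d ∸ k
          i₀ = g + suc m
          i≡k+i₀ : i ≡ k + i₀
          i≡k+i₀ = trans (sym i≡) (trans (cong (λ e → g + suc e) (sym (m+[n∸m]≡n (≮⇒≥ d≮k))))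
                     (trans (cong (g +_) (sym (+-suc k m))) (x∙yz≈y∙xz g k (suc m))))
          lift-i₀ : lift i₀ ≡ i
          lift-i₀ with i₀ ≤? g
          ... | yes i₀≤g = ⊥-elim (<-irrefl refl (≤-<-trans i₀≤g (m<m+n g z<s)))
          ... | no  _    = sym i≡k+i₀
          i₀≤|w| : i₀ ≤ length w
          i₀≤|w| = subst (i₀ ≤_) (sym length-w) (+-cancelˡ-≤ k i₀ (g + V)
                     (subst₂ _≤_ i≡k+i₀ (trans length-w' (x∙yz≈y∙xz g k V)) i≤|w'|))

  letter<N : ∀ i → at w i < N
  letter<N = at-All {P = _< N} w (All.++⁺ u<N v<N) z<s

  letter≤N : ∀ i → at w' i ≤ N
  letter≤N = at-All {P = _≤ N} w' (All.++⁺ (All.map <⇒≤ u<N) (All.++⁺ (All.replicate⁺ k ≤-refl) (All.map <⇒≤ v<N))) z≤n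

  N-in-block : ∀ i → at w' i ≡ N → g < i × i ≤ g + k
  N-in-block i ai≡N with i ≤? g
  ... | yes i≤g = ⊥-elim (<⇒≢ (letter<N i) (trans (sym (letter-left i i≤g)) ai≡N))
  ... | no  i≰g with i ≤? g + k
  ...   | yes i≤g+k = ≰⇒> i≰g , i≤g+k
  ...   | no  i≰g+k = ⊥-elim (<⇒≢ (letter<N (g + suc m)) (trans (sym (letter-right m)) (trans (cong (at w') i≡) ai≡N)))
    where
      m : ℕ
      m = i ∸ suc (g + k)
      i≡ : g + (k + suc m) ≡ i
      i≡ = trans (sym (+-assoc g k (suc m))) (trans (+-suc (g + k) m) (m+[n∸m]≡n (≰⇒> i≰g+k)))

  block-letter : ∀ i → g < i → i ≤ g + k → at w' i ≡ N
  block-letter i g<i i≤g+k = trans (cong (at w') (sym (beyond-gap i (<⇒≱ g<i))))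
    (letter-block (i ∸ suc g) (+-cancelˡ-≤ g (suc (i ∸ suc g)) k (subst (_≤ g + k) (sym (beyond-gap i (<⇒≱ g<i))) i≤g+k)))

  pattern-pullback : StirlingPattern w' → StirlingPattern w
  pattern-pullback condition p q r 1≤p p<q q<r r≤|w| ap≡ar = subst₂ _≤_ (lift-letter r) (lift-letter q)
    (condition (lift p) (lift q) (lift r) (≤-trans 1≤p (lift-inflationary p)) (lift-monotone p q p<q) (lift-monotone q r q<r)
             (lift-bounded r r≤|w|) (trans (lift-letter p) (trans ap≡ar (sym (lift-letter r)))))

  -- ... and from w to w', because the inserted block is contiguous and maximal.
  pattern-pushforward : StirlingPattern w → StirlingPattern w'
  pattern-pushforward condition p q r 1≤p p<q q<r r≤|w'| ap≡ar with at w' q ≟ N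
  ... | yes aq≡N = subst (at w' r ≤_) (sym aq≡N) (letter≤N r)
  ... | no  aq≢N with at w' r ≟ N
  ...   | yes ar≡N = ⊥-elim (aq≢N (block-letter q (<-trans (proj₁ (N-in-block p (trans ap≡ar ar≡N))) p<q)
                                                    (≤-trans (<⇒≤ q<r) (proj₂ (N-in-block r ar≡N)))))
  ...   | no  ar≢N with lift-onto p 1≤p p≤|w'| (λ ap≡N → ar≢N (trans (sym ap≡ar) ap≡N))
                      | lift-onto q 1≤q q≤|w'| aq≢N | lift-onto r 1≤r r≤|w'| ar≢N
    where
      q≤|w'| = ≤-trans (<⇒≤ q<r) r≤|w'|
      p≤|w'| = ≤-trans (<⇒≤ p<q) q≤|w'|
      1≤q = ≤-trans 1≤p (<⇒≤ p<q)
      1≤r = ≤-trans 1≤q (<⇒≤ q<r)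
  ... | p₀ , refl , 1≤p₀ , _ | q₀ , refl , _ , _ | r₀ , refl , _ , r₀≤|w| =
    subst₂ _≤_ (sym (lift-letter r₀)) (sym (lift-letter q₀))
      (condition p₀ q₀ r₀ 1≤p₀ (lift-reflects p₀ q₀ p<q) (lift-reflects q₀ r₀ q<r) r₀≤|w|
               (trans (sym (lift-letter p₀)) (trans ap≡ar (lift-letter r₀))))

insertBlock : ℕ → ℕ → ℕ → List ℕ → List ℕ
insertBlock k N g w = take g w ++ (replicate k N ++ drop g w)

insertBlock-gap-formula : ∀ n k' Q w g → g ≤ length w → All (_< suc n) w →
  localCount Q (insertBlock (suc k') (suc n) g w) + 𝟙 (localAt Q w g) ≡ localCount Q w + newPairs k' (suc n) w g Q
insertBlock-gap-formula n k' Q w g g≤|w| w<N =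
  split (take g w) (drop g w) (take++drop≡id g w) (trans (length-take g w) (m≤n⇒m⊓n≡m g≤|w|))
        (All.take⁺ g w<N) (All.drop⁺ g w<N)
  where
    split : ∀ u v → u ++ v ≡ w → length u ≡ g → All (_< suc n) u → All (_< suc n) v →
      localCount Q (u ++ (replicate (suc k') (suc n) ++ v)) + 𝟙 (localAt Q w g) ≡ localCount Q w + newPairs k' (suc n) w g Q
    split u v refl refl u<N v<N = BlockInsertion.gap-formula n k' u v u<N v<N Q

ascent descent plateau : LocalTest
ascent  a b _ _ = a <ᵇ b
descent a b _ _ = b <ᵇ a
plateau a b _ _ = a ≡ᵇ b

jAscent jDescent jPlateau : ℕ → LocalTest
jAscent  j a b o _  = (a <ᵇ b) ∧ (o ≡ᵇ j)
jDescent j a b _ o' = (b <ᵇ a) ∧ ((0 <ᵇ b) ∧ (o' ≡ᵇ j))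
jPlateau j a b o _  = (a ≡ᵇ b) ∧ (o ≡ᵇ j)

Xstat-local : ∀ w → Xstat w ≡ localCount ascent w
Xstat-local w = countB-fromTo (isAsc w) 0 (length w)

Ystat-local : ∀ w → Ystat w ≡ localCount descent w
Ystat-local w = countB-fromTo (isDesc w) 0 (length w)

Zstat-local : ∀ w → Zstat w ≡ localCount plateau w
Zstat-local w = countB-fromTo (isPlat w) 0 (length w)

-- Index 0 never counts for j ≥ 1, since a_0 is no occurrence of anything.
Xj-local : ∀ j w → 1 ≤ j → Xj j w ≡ localCount (jAscent j) w
Xj-local (suc j) w _ = trans (countB-fromTo _ 1 (length w))
  (cong (_+ countBelow (λ i → localAt (jAscent (suc j)) w (suc i)) (length w)) (sym (cong 𝟙 (∧-zeroʳ (at w 0 <ᵇ at w 1)))))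

Zj-local : ∀ j w → 1 ≤ j → Zj j w ≡ localCount (jPlateau j) w
Zj-local (suc j) w _ = trans (countB-fromTo _ 1 (length w))
  (cong (_+ countBelow (λ i → localAt (jPlateau (suc j)) w (suc i)) (length w)) (sym (cong 𝟙 (∧-zeroʳ (at w 0 ≡ᵇ at w 1)))))

-- For j-descents the guard 0 < a_{i+1} excludes the last index, where
-- a_{|w|+1} = 0; it is harmless inside the word, whose letters are positive.
Yj-local : ∀ j w → All (1 ≤_) w → Yj j w ≡ localCount (jDescent j) w
Yj-local j []      _        = refl
Yj-local j (x ∷ w) positive = begin
  Yj j (x ∷ w)
    ≡⟨ countB-fromTo _ 1 (length w) ⟩
  countBelow (λ i → isDesc (x ∷ w) (suc i) ∧ (occ (x ∷ w) (suc (suc i)) ≡ᵇ j)) (length w)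
    ≡⟨ sumBelow-cong (length w) (λ i i<|w| → cong 𝟙 (guard-holds i i<|w|)) ⟩
  countBelow (λ i → P (suc i)) (length w)
    ≡⟨ +-identityʳ _ ⟨
  countBelow (λ i → P (suc i)) (length w) + 0
    ≡⟨ cong (countBelow (λ i → P (suc i)) (length w) +_) last-fails ⟨
  countBelow (λ i → P (suc i)) (length w) + countBelow (λ i → P (suc (length w + i))) 1
    ≡⟨ sumBelow-split _ (length w) 1 ⟨
  countBelow (λ i → P (suc i)) (length w + 1)
    ≡⟨ cong (countBelow (λ i → P (suc i))) (+-comm (length w) 1) ⟩
  localCount (jDescent j) (x ∷ w) ∎
  where
    open ≡-Reasoning
    P : ℕ → Bool
    P = localAt (jDescent j) (x ∷ w)
    guard-holds : ∀ i → i < length w → (isDesc (x ∷ w) (suc i) ∧ (occ (x ∷ w) (suc (suc i)) ≡ᵇ j)) ≡ P (suc i)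
    guard-holds i i<|w| = cong (λ b → isDesc (x ∷ w) (suc i) ∧ (b ∧ (occ (x ∷ w) (suc (suc i)) ≡ᵇ j)))
      (sym (<ᵇ-true (at-All-inside (x ∷ w) positive (suc (suc i)) (s≤s z≤n) (s≤s i<|w|))))
    last-fails : countBelow (λ i → P (suc (length w + i))) 1 ≡ 0
    last-fails = cong (λ b → 𝟙 b + 0) (trans
      (cong (λ a → (a <ᵇ at (x ∷ w) (suc (length w + 0))) ∧ ((0 <ᵇ a) ∧ (occ (x ∷ w) (suc (suc (length w + 0))) ≡ᵇ j)))
            (at-beyond (x ∷ w) (suc (suc (length w + 0))) (s≤s (s≤s (m≤m+n (length w) 0)))))
      (∧-zeroʳ _))

module GapEffect (n k' : ℕ) (w : List ℕ) (w<N : All (_< suc n) w) (g : ℕ) (g≤|w| : g ≤ length w) where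
  N k : ℕ
  N = suc n
  k = suc k'

  w' : List ℕ
  w' = insertBlock k N g w

  private
    letter<N : ∀ i → at w i < N
    letter<N = at-All {P = _< N} w w<N z<s

    letter≢N : ∀ i → (at w i ≡ᵇ N) ≡ false
    letter≢N i = ≡ᵇ-false (<⇒≢ (letter<N i))

    N≢letter : ∀ i → (N ≡ᵇ at w i) ≡ false
    N≢letter i = trans (≡ᵇ-comm N (at w i)) (letter≢N i)

    effect : ∀ (F : List ℕ → ℕ) Q c → F w' ≡ localCount Q w' → F w ≡ localCount Q w →
             newPairs k' N w g Q ≡ c → F w' + 𝟙 (localAt Q w g) ≡ F w + c
    effect F Q c F-w' F-w new≡c = begin
      F w' + 𝟙 (localAt Q w g)                ≡⟨ cong (_+ 𝟙 (localAt Q w g)) F-w' ⟩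
      localCount Q w' + 𝟙 (localAt Q w g)     ≡⟨ insertBlock-gap-formula n k' Q w g g≤|w| w<N ⟩
      localCount Q w + newPairs k' N w g Q    ≡⟨ cong₂ _+_ (sym F-w) new≡c ⟩
      F w + c                                 ∎
      where open ≡-Reasoning

    no-pair-inside : ∀ (P : ℕ → Bool) → (∀ i → P i ≡ false) → countBelow P k' ≡ 0
    no-pair-inside P none = countBelow-none k' (λ i _ → none i)

  -- One new ascent (a_g , N) and one new descent (N , a_{g+1}) ...
  ascents : Xstat w' + 𝟙 (isAsc w g) ≡ Xstat w + 1
  ascents = effect Xstat ascent 1 (Xstat-local w') (Xstat-local w)
    (cong₂ (λ b c → 𝟙 b + c) (<ᵇ-true (letter<N g))
      (cong₂ (λ c b → c + 𝟙 b) (no-pair-inside _ (λ _ → <ᵇ-irreflexive N)) (<ᵇ-false (<⇒≤ (letter<N (suc g))))))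

  descents : Ystat w' + 𝟙 (isDesc w g) ≡ Ystat w + 1
  descents = effect Ystat descent 1 (Ystat-local w') (Ystat-local w)
    (cong₂ (λ b c → 𝟙 b + c) (<ᵇ-false (<⇒≤ (letter<N g)))
      (cong₂ (λ c b → c + 𝟙 b) (no-pair-inside _ (λ _ → <ᵇ-irreflexive N)) (<ᵇ-true (letter<N (suc g)))))

  -- ... and k-1 new plateaux inside the block.
  plateaux : Zstat w' + 𝟙 (isPlat w g) ≡ Zstat w + k'
  plateaux = effect Zstat plateau k' (Zstat-local w') (Zstat-local w)
    (cong₂ (λ b c → 𝟙 b + c) (letter≢N g)
      (trans (cong₂ (λ c b → c + 𝟙 b) (countBelow-all k' (λ _ _ → ≡ᵇ-true (refl {x = N}))) (N≢letter (suc g)))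
             (+-identityʳ k')))

  -- The new ascent (a_g , N) is a j-ascent iff a_g is a j-th occurrence.
  jAscents : ∀ j → 1 ≤ j → Xj j w' + 𝟙 (localAt (jAscent j) w g) ≡ Xj j w + 𝟙 (occ w g ≡ᵇ j)
  jAscents j 1≤j = effect (Xj j) (jAscent j) _ (Xj-local j w' 1≤j) (Xj-local j w 1≤j)
    (trans (cong₂ (λ b c → 𝟙 (b ∧ (occ w g ≡ᵇ j)) + c) (<ᵇ-true (letter<N g))
             (cong₂ (λ c b → c + 𝟙 (b ∧ (k ≡ᵇ j)))
               (no-pair-inside _ (λ i → cong (_∧ (suc i ≡ᵇ j)) (<ᵇ-irreflexive N))) (<ᵇ-false (<⇒≤ (letter<N (suc g))))))
           (+-identityʳ _))

  -- The new descent (N , a_{g+1}) is a j-descent iff a_{g+1} is a j-th occurrence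
  -- (and a letter, not the final 0).
  jDescents : ∀ j → All (1 ≤_) w →
    Yj j w' + 𝟙 (localAt (jDescent j) w g) ≡ Yj j w + 𝟙 ((0 <ᵇ at w (suc g)) ∧ (occ w (suc g) ≡ᵇ j))
  jDescents j positive = effect (Yj j) (jDescent j) _ (Yj-local j w' positive′) (Yj-local j w positive)
    (cong₂ (λ b c → 𝟙 (b ∧ ((0 <ᵇ N) ∧ (1 ≡ᵇ j))) + c) (<ᵇ-false (<⇒≤ (letter<N g)))
      (cong₂ (λ c b → c + 𝟙 (b ∧ ((0 <ᵇ at w (suc g)) ∧ (occ w (suc g) ≡ᵇ j))))
        (no-pair-inside _ (λ i → cong (_∧ ((0 <ᵇ N) ∧ (suc (suc i) ≡ᵇ j))) (<ᵇ-irreflexive N)))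
        (<ᵇ-true (letter<N (suc g)))))
    where
      positive′ : All (1 ≤_) w'
      positive′ = All.++⁺ (All.take⁺ g positive) (All.++⁺ (All.replicate⁺ k (s≤s z≤n)) (All.drop⁺ g positive))

  -- Exactly one plateau inside the block, (N_j , N_{j+1}), is a j-plateau.
  jPlateaux : ∀ j → 1 ≤ j → j ≤ k' → Zj j w' + 𝟙 (localAt (jPlateau j) w g) ≡ Zj j w + 1
  jPlateaux j 1≤j j≤k' = effect (Zj j) (jPlateau j) 1 (Zj-local j w' 1≤j) (Zj-local j w 1≤j)
    (cong₂ (λ b c → 𝟙 (b ∧ (occ w g ≡ᵇ j)) + c) (letter≢N g)
      (cong₂ (λ c b → c + 𝟙 (b ∧ (k ≡ᵇ j)))
        (trans (sumBelow-cong k' (λ i _ → cong 𝟙 (trans (cong (_∧ (suc i ≡ᵇ j)) (≡ᵇ-true (refl {x = N}))) (≡ᵇ-comm (suc i) j))))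
               (countBelow-singleton j k' 1≤j j≤k'))
        (N≢letter (suc g))))

-- Summing the gap identity of a local statistic F = localCount Q over the
-- |w|+1 gaps: the destroyed pairs add up to F w itself.
sum-over-gaps : ∀ (F : List ℕ → ℕ) Q (ins : ℕ → List ℕ) (d : ℕ → ℕ) w → F w ≡ localCount Q w →
  (∀ g → g ≤ length w → F (ins g) + 𝟙 (localAt Q w g) ≡ F w + d g) →
  sumBelow (λ g → F (ins g)) (suc (length w)) ≡ length w * F w + sumBelow d (suc (length w))
sum-over-gaps F Q ins d w F-local gap = +-cancelʳ-≡ (F w) _ _ (begin
  sumBelow (λ g → F (ins g)) L + F w
    ≡⟨ cong (sumBelow (λ g → F (ins g)) L +_) F-local ⟩
  sumBelow (λ g → F (ins g)) L + countBelow (localAt Q w) L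
    ≡⟨ sumBelow-+ (λ g → F (ins g)) (λ g → 𝟙 (localAt Q w g)) L ⟨
  sumBelow (λ g → F (ins g) + 𝟙 (localAt Q w g)) L
    ≡⟨ sumBelow-cong L (λ g g<L → gap g (s≤s⁻¹ g<L)) ⟩
  sumBelow (λ g → F w + d g) L
    ≡⟨ sumBelow-+ (λ _ → F w) d L ⟩
  sumBelow (λ _ → F w) L + sumBelow d L
    ≡⟨ cong (_+ sumBelow d L) (sumBelow-const (F w) L) ⟩
  F w + length w * F w + sumBelow d L
    ≡⟨ rotate (F w) (length w * F w) (sumBelow d L) ⟩
  length w * F w + sumBelow d L + F w ∎)
  where
    open ≡-Reasoning
    rotate : ∀ a b c → a + b + c ≡ b + c + a
    rotate = solve-∀
    L : ℕ
    L = suc (length w)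

multiplicity : ℕ → List ℕ → ℕ
multiplicity x = countB (λ a → a ≡ᵇ x)

InAlphabet : ℕ → ℕ → Set
InAlphabet n a = (1 ≤ a) × (a ≤ n)

occ-∷ʳ-before : ∀ w y i → suc i ≤ length w → occ (w ∷ʳ y) (suc i) ≡ occ w (suc i)
occ-∷ʳ-before w y i i<|w| = begin
  occ (w ∷ʳ y) (suc i)                          ≡⟨ occ-prefixCount (w ∷ʳ y) (suc i) ⟩
  prefixCount (w ∷ʳ y) (at (w ∷ʳ y) (suc i)) (suc i) ≡⟨ cong (λ a → prefixCount (w ∷ʳ y) a (suc i)) (at-++ˡ w (y ∷ []) (suc i) i<|w|) ⟩
  prefixCount (w ∷ʳ y) (at w (suc i)) (suc i)   ≡⟨ prefixCount-++ˡ w (y ∷ []) _ (suc i) i<|w| ⟩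
  prefixCount w (at w (suc i)) (suc i)          ≡⟨ occ-prefixCount w (suc i) ⟨
  occ w (suc i)                                 ∎
  where open ≡-Reasoning

prefixCount-all : ∀ w x → prefixCount w x (length w) ≡ multiplicity x w
prefixCount-all []      x = refl
prefixCount-all (a ∷ w) x = trans (cong (𝟙 (a ≡ᵇ x) +_) (prefixCount-all w x)) (sym (countB-cons _ a w))

occ-∷ʳ-last : ∀ w y → occ (w ∷ʳ y) (length w + 1) ≡ suc (multiplicity y w)
occ-∷ʳ-last w y = begin
  occ (w ∷ʳ y) (length w + 1)                                   ≡⟨ occ-prefixCount (w ∷ʳ y) (length w + 1) ⟩
  prefixCount (w ∷ʳ y) (at (w ∷ʳ y) (length w + 1)) (length w + 1) ≡⟨ cong (λ a → prefixCount (w ∷ʳ y) a (length w + 1)) (at-++ʳ w (y ∷ []) 0) ⟩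
  prefixCount (w ∷ʳ y) y (length w + 1)                         ≡⟨ prefixCount-++ w (y ∷ []) y 1 ⟩
  prefixCount w y (length w) + (𝟙 (y ≡ᵇ y) + 0)                ≡⟨ cong₂ (λ c b → c + (𝟙 b + 0)) (prefixCount-all w y) (≡ᵇ-true (refl {x = y})) ⟩
  multiplicity y w + 1                                          ≡⟨ +-comm _ 1 ⟩
  suc (multiplicity y w)                                        ∎
  where open ≡-Reasoning

𝟙-≤ᵇ-suc : ∀ j c → 𝟙 (j ≤ᵇ suc c) ≡ 𝟙 (j ≤ᵇ c) + 𝟙 (suc c ≡ᵇ j)
𝟙-≤ᵇ-suc zero                c       = refl
𝟙-≤ᵇ-suc (suc zero)          zero    = refl
𝟙-≤ᵇ-suc (suc zero)          (suc c) = refl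
𝟙-≤ᵇ-suc (suc (suc j))       zero    = refl
𝟙-≤ᵇ-suc (suc (suc j))       (suc c) = 𝟙-≤ᵇ-suc (suc j) c

positive-≰0 : ∀ {j} → 1 ≤ j → (j ≤ᵇ 0) ≡ false
positive-≰0 {suc j} _ = refl

occurrence-profile : ∀ n j w → 1 ≤ j → All (InAlphabet n) w →
  countBelow (λ i → occ w (suc i) ≡ᵇ j) (length w) ≡ countBelow (λ x → j ≤ᵇ multiplicity (suc x) w) n
occurrence-profile n j w 1≤j = go w (reverseView w)
  where
    go : ∀ w → Reverse w → All (InAlphabet n) w →
         countBelow (λ i → occ w (suc i) ≡ᵇ j) (length w) ≡ countBelow (λ x → j ≤ᵇ multiplicity (suc x) w) n
    go .[] [] _ = sym (countBelow-none n (λ _ _ → positive-≰0 1≤j))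
    go .(w ∷ʳ y) (w ∶ rw ∶ʳ y) in-alphabet = begin
      countBelow (λ i → occ (w ∷ʳ y) (suc i) ≡ᵇ j) (length (w ∷ʳ y))
        ≡⟨ cong (countBelow (λ i → occ (w ∷ʳ y) (suc i) ≡ᵇ j)) (length-++ w) ⟩
      countBelow (λ i → occ (w ∷ʳ y) (suc i) ≡ᵇ j) (length w + 1)
        ≡⟨ sumBelow-split _ (length w) 1 ⟩
      countBelow (λ i → occ (w ∷ʳ y) (suc i) ≡ᵇ j) (length w) + (𝟙 (occ (w ∷ʳ y) (suc (length w + 0)) ≡ᵇ j) + 0)
        ≡⟨ cong₂ _+_ (sumBelow-cong (length w) (λ i i<|w| → cong (λ o → 𝟙 (o ≡ᵇ j)) (occ-∷ʳ-before w y i i<|w|)))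
                     (trans (+-identityʳ _) (cong (λ o → 𝟙 (o ≡ᵇ j)) last-occ)) ⟩
      countBelow (λ i → occ w (suc i) ≡ᵇ j) (length w) + new
        ≡⟨ cong (_+ new) (go w rw (All.++⁻ˡ w in-alphabet)) ⟩
      countBelow (λ x → j ≤ᵇ multiplicity (suc x) w) n + new
        ≡⟨ cong (countBelow (λ x → j ≤ᵇ multiplicity (suc x) w) n +_) new-value ⟩
      countBelow (λ x → j ≤ᵇ multiplicity (suc x) w) n + sumBelow (λ x → 𝟙 (y ≡ᵇ suc x) * new) n
        ≡⟨ sumBelow-+ _ _ n ⟨
      sumBelow (λ x → 𝟙 (j ≤ᵇ multiplicity (suc x) w) + 𝟙 (y ≡ᵇ suc x) * new) n
        ≡⟨ sumBelow-cong n (λ x _ → sym (count-grows x)) ⟩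
      countBelow (λ x → j ≤ᵇ multiplicity (suc x) (w ∷ʳ y)) n ∎
      where
        open ≡-Reasoning
        new : ℕ
        new = 𝟙 (suc (multiplicity y w) ≡ᵇ j)
        last-occ : occ (w ∷ʳ y) (suc (length w + 0)) ≡ suc (multiplicity y w)
        last-occ = trans (cong (occ (w ∷ʳ y)) (+-comm 1 (length w + 0) ∙ cong (_+ 1) (+-identityʳ (length w))))
                         (occ-∷ʳ-last w y)
          where _∙_ = trans
        y-in-alphabet : InAlphabet n y
        y-in-alphabet = All.head (All.++⁻ʳ w in-alphabet)
        new-value : new ≡ sumBelow (λ x → 𝟙 (y ≡ᵇ suc x) * new) n
        new-value = sym (trans (sumBelow-*ʳ (λ x → 𝟙 (y ≡ᵇ suc x)) new n)
          (trans (cong (_* new) (countBelow-singleton y n (proj₁ y-in-alphabet) (proj₂ y-in-alphabet))) (+-identityʳ new)))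
        count-grows : ∀ x → 𝟙 (j ≤ᵇ multiplicity (suc x) (w ∷ʳ y)) ≡ 𝟙 (j ≤ᵇ multiplicity (suc x) w) + 𝟙 (y ≡ᵇ suc x) * new
        count-grows x with y ≡ᵇ suc x in y≡x+1
        ... | true  rewrite countB-++ (λ a → a ≡ᵇ suc x) w (y ∷ []) | y≡x+1 | ≡ᵇ-sound y (suc x) y≡x+1
                    = trans (cong (λ c → 𝟙 (j ≤ᵇ c)) (+-comm (multiplicity (suc x) w) 1))
                            (trans (𝟙-≤ᵇ-suc j _) (cong (𝟙 (j ≤ᵇ multiplicity (suc x) w) +_) (sym (+-identityʳ _))))
        ... | false rewrite countB-++ (λ a → a ≡ᵇ suc x) w (y ∷ []) | y≡x+1
                    = cong (λ c → 𝟙 (j ≤ᵇ c)) (+-identityʳ _) ∙ sym (+-identityʳ _)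
          where _∙_ = trans

length-by-multiplicities : ∀ n w → All (InAlphabet n) w → length w ≡ sumBelow (λ x → multiplicity (suc x) w) n
length-by-multiplicities n []      []                  = sym (sumBelow-zero n (λ _ _ → refl))
length-by-multiplicities n (y ∷ w) ((1≤y , y≤n) ∷ rest) = sym (begin
  sumBelow (λ x → multiplicity (suc x) (y ∷ w)) n
    ≡⟨ sumBelow-cong n (λ x _ → countB-cons (λ a → a ≡ᵇ suc x) y w) ⟩
  sumBelow (λ x → 𝟙 (y ≡ᵇ suc x) + multiplicity (suc x) w) n
    ≡⟨ sumBelow-+ (λ x → 𝟙 (y ≡ᵇ suc x)) (λ x → multiplicity (suc x) w) n ⟩
  countBelow (λ x → y ≡ᵇ suc x) n + sumBelow (λ x → multiplicity (suc x) w) n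
    ≡⟨ cong₂ _+_ (countBelow-singleton y n 1≤y y≤n) (sym (length-by-multiplicities n w rest)) ⟩
  suc (length w) ∎)
  where open ≡-Reasoning

module Stirling {k n w} (stirling : IsStirling k n w) where

  in-alphabet : All (InAlphabet n) w
  in-alphabet = proj₁ stirling

  letters<n+1 : All (_< suc n) w
  letters<n+1 = All.map (λ a∈ → s≤s (proj₂ a∈)) in-alphabet

  positive : All (1 ≤_) w
  positive = All.map proj₁ in-alphabet

  multiplicity-k : ∀ x → x < n → multiplicity (suc x) w ≡ k
  multiplicity-k x x<n = proj₁ (proj₂ stirling) (suc x) (s≤s z≤n) x<n

  length-kn : length w ≡ k * n
  length-kn = trans (length-by-multiplicities n w in-alphabet)
    (trans (sumBelow-cong n multiplicity-k) (trans (sumBelow-const k n) (*-comm n k)))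

  jth-occurrences : ∀ j → 1 ≤ j → j ≤ k → countBelow (λ i → occ w (suc i) ≡ᵇ j) (length w) ≡ n
  jth-occurrences j 1≤j j≤k = trans (occurrence-profile n j w 1≤j in-alphabet)
    (countBelow-all n (λ x x<n → trans (cong (j ≤ᵇ_) (multiplicity-k x x<n)) (Equivalence.to T-≡ (≤⇒≤ᵇ j≤k))))

  jth-occurrences-before-gaps : ∀ j → 1 ≤ j → j ≤ k → countBelow (λ g → occ w g ≡ᵇ j) (suc (length w)) ≡ n
  jth-occurrences-before-gaps (suc j) = jth-occurrences (suc j)

  jth-occurrences-after-gaps : ∀ j → 1 ≤ j → j ≤ k →
    countBelow (λ g → (0 <ᵇ at w (suc g)) ∧ (occ w (suc g) ≡ᵇ j)) (suc (length w)) ≡ n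
  jth-occurrences-after-gaps j 1≤j j≤k = begin
    countBelow P (suc (length w))
      ≡⟨ cong (countBelow P) (+-comm 1 (length w)) ⟩
    countBelow P (length w + 1)
      ≡⟨ sumBelow-split _ (length w) 1 ⟩
    countBelow P (length w) + (𝟙 (P (length w + 0)) + 0)
      ≡⟨ cong₂ _+_ (sumBelow-cong (length w) (λ i i<|w| → cong (λ b → 𝟙 (b ∧ (occ w (suc i) ≡ᵇ j)))
                      (<ᵇ-true (at-All-inside w positive (suc i) (s≤s z≤n) i<|w|))))
                   (cong (λ a → 𝟙 ((0 <ᵇ a) ∧ (occ w (suc (length w + 0)) ≡ᵇ j)) + 0) (at-beyond w (suc (length w + 0)) (s≤s (m≤m+n (length w) 0)))) ⟩
    countBelow (λ i → occ w (suc i) ≡ᵇ j) (length w) + 0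
      ≡⟨ +-identityʳ _ ⟩
    countBelow (λ i → occ w (suc i) ≡ᵇ j) (length w)
      ≡⟨ jth-occurrences j 1≤j j≤k ⟩
    n ∎
    where
      open ≡-Reasoning
      P : ℕ → Bool
      P g = (0 <ᵇ at w (suc g)) ∧ (occ w (suc g) ≡ᵇ j)

multiplicity-++ : ∀ x u v → multiplicity x (u ++ v) ≡ multiplicity x u + multiplicity x v
multiplicity-++ x = countB-++ (λ a → a ≡ᵇ x)

multiplicity-absent : ∀ x u → All (λ a → ¬ a ≡ x) u → multiplicity x u ≡ 0
multiplicity-absent x []      []           = refl
multiplicity-absent x (a ∷ u) (a≢x ∷ rest) =
  trans (countB-cons (λ a → a ≡ᵇ x) a u) (cong₂ _+_ (cong 𝟙 (≡ᵇ-false a≢x)) (multiplicity-absent x u rest))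

multiplicity-replicate : ∀ x k N → multiplicity x (replicate k N) ≡ k * 𝟙 (N ≡ᵇ x)
multiplicity-replicate x zero    N = refl
multiplicity-replicate x (suc k) N = trans (countB-cons (λ a → a ≡ᵇ x) N (replicate k N)) (cong (𝟙 (N ≡ᵇ x) +_) (multiplicity-replicate x k N))

multiplicity-positive : ∀ x l → 1 ≤ multiplicity x l → x ∈ l
multiplicity-positive x (a ∷ l) 1≤m with a ≟ x
... | yes refl = here refl
... | no  a≢x  = there (multiplicity-positive x l (subst (1 ≤_) (trans (countB-cons (λ b → b ≡ᵇ x) a l) (cong (_+ multiplicity x l) (cong 𝟙 (≡ᵇ-false a≢x)))) 1≤m))

module BlockMultiplicities (N k : ℕ) (u v : List ℕ) where

  of-N : All (λ a → ¬ a ≡ N) u → All (λ a → ¬ a ≡ N) v → multiplicity N (u ++ (replicate k N ++ v)) ≡ k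
  of-N u∌N v∌N = begin
    multiplicity N (u ++ (replicate k N ++ v))                        ≡⟨ multiplicity-++ N u _ ⟩
    multiplicity N u + multiplicity N (replicate k N ++ v)           ≡⟨ cong₂ _+_ (multiplicity-absent N u u∌N) (multiplicity-++ N (replicate k N) v) ⟩
    multiplicity N (replicate k N) + multiplicity N v                ≡⟨ cong₂ _+_ (multiplicity-replicate N k N) (multiplicity-absent N v v∌N) ⟩
    k * 𝟙 (N ≡ᵇ N) + 0                                               ≡⟨ cong (λ b → k * 𝟙 b + 0) (≡ᵇ-true (refl {x = N})) ⟩
    k * 1 + 0                                                         ≡⟨ trans (+-identityʳ _) (*-identityʳ k) ⟩
    k                                                                 ∎
    where open ≡-Reasoning

  of-other : ∀ x → ¬ x ≡ N → multiplicity x (u ++ (replicate k N ++ v)) ≡ multiplicity x (u ++ v)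
  of-other x x≢N = begin
    multiplicity x (u ++ (replicate k N ++ v))                        ≡⟨ multiplicity-++ x u _ ⟩
    multiplicity x u + multiplicity x (replicate k N ++ v)           ≡⟨ cong (multiplicity x u +_) (multiplicity-++ x (replicate k N) v) ⟩
    multiplicity x u + (multiplicity x (replicate k N) + multiplicity x v)
      ≡⟨ cong (λ c → multiplicity x u + (c + multiplicity x v)) (trans (multiplicity-replicate x k N) (cong (λ b → k * 𝟙 b) (≡ᵇ-false (λ N≡x → x≢N (sym N≡x))))) ⟩
    multiplicity x u + (k * 0 + multiplicity x v)                    ≡⟨ cong (λ c → multiplicity x u + (c + multiplicity x v)) (*-zeroʳ k) ⟩
    multiplicity x u + multiplicity x v                               ≡⟨ multiplicity-++ x u v ⟨
    multiplicity x (u ++ v)                                           ∎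
    where open ≡-Reasoning

insert-stirling : ∀ {k' n} u v → IsStirling (suc k') n (u ++ v) →
  IsStirling (suc k') (suc n) (u ++ (replicate (suc k') (suc n) ++ v))
insert-stirling {k'} {n} u v (alphabet , multiplicities , condition) =
  All.++⁺ (widen u-alphabet) (All.++⁺ (All.replicate⁺ k (s≤s z≤n , ≤-refl)) (widen v-alphabet)) ,
  multiplicities′ ,
  BlockInsertion.pattern-pushforward n k' u v u<N v<N condition
  where
    k N : ℕ
    k = suc k'
    N = suc n
    u-alphabet : All (InAlphabet n) u
    u-alphabet = All.++⁻ˡ u alphabet
    v-alphabet : All (InAlphabet n) v
    v-alphabet = All.++⁻ʳ u alphabet
    widen : ∀ {l} → All (InAlphabet n) l → All (InAlphabet N) l
    widen = All.map (λ (1≤a , a≤n) → 1≤a , m≤n⇒m≤1+n a≤n)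
    below : ∀ {l} → All (InAlphabet n) l → All (_< N) l
    below = All.map (λ a∈ → s≤s (proj₂ a∈))
    u<N = below u-alphabet
    v<N = below v-alphabet
    multiplicities′ : ∀ i → 1 ≤ i → i ≤ N → multiplicity i (u ++ (replicate k N ++ v)) ≡ k
    multiplicities′ i 1≤i i≤N with i ≟ N
    ... | yes refl = BlockMultiplicities.of-N N k u v (All.map <⇒≢ u<N) (All.map <⇒≢ v<N)
    ... | no  i≢N  = trans (BlockMultiplicities.of-other N k u v i i≢N)
                           (multiplicities i 1≤i (s≤s⁻¹ (≤∧≢⇒< i≤N i≢N)))

split-at-first : ∀ x l → x ∈ l → ∃[ u ] ∃[ rest ] (l ≡ u ++ x ∷ rest) × All (λ a → ¬ a ≡ x) u
split-at-first x (a ∷ l) x∈ with a ≟ x | x∈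
... | yes refl | _         = [] , l , refl , []
... | no  a≢x  | here x≡a  = ⊥-elim (a≢x (sym x≡a))
... | no  a≢x  | there x∈l = let (u , rest , l≡ , u∌x) = split-at-first x l x∈l in
  a ∷ u , rest , cong (a ∷_) l≡ , a≢x ∷ u∌x

StartsWith : ℕ → List ℕ → Set
StartsWith x []      = ⊥
StartsWith x (y ∷ _) = y ≡ x

split-run : ∀ x s → ∃[ a ] ∃[ v ] (s ≡ replicate a x ++ v) × ¬ StartsWith x v
split-run x []      = 0 , [] , refl , λ ()
split-run x (y ∷ s) with y ≟ x
... | yes refl = let (a , v , s≡ , stop) = split-run x s in suc a , v , cong (x ∷_) s≡ , stop
... | no  y≢x  = 0 , y ∷ s , refl , y≢x

∈⇒at : ∀ {x} l → x ∈ l → ∃[ i ] (i < length l) × (at l (suc i) ≡ x)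
∈⇒at (a ∷ l) (here refl) = 0 , z<s , refl
∈⇒at (a ∷ l) (there x∈) with ∈⇒at l x∈
... | zero  , i<|l| , ai≡x = 1 , s<s i<|l| , ai≡x
... | suc i , i<|l| , ai≡x = suc (suc i) , s<s i<|l| , ai≡x

-- In a Stirling word whose largest letter is N, no N follows a maximal run of
-- N's: the letter y ending the run would lie between two N's although y < N.
no-N-after-run : ∀ N u a y t → StirlingPattern (u ++ N ∷ (replicate a N ++ y ∷ t)) → y ≤ N → ¬ y ≡ N →
                 All (λ x → ¬ x ≡ N) t
no-N-after-run N u a y t condition y≤N y≢N = All.tabulate λ {x} x∈t x≡N → N-after x∈t x≡N
  where
    w   = u ++ N ∷ (replicate a N ++ y ∷ t)
    pre = u ++ N ∷ replicate a N
    w≡ : w ≡ pre ++ y ∷ t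
    w≡ = sym (++-assoc u (N ∷ replicate a N) (y ∷ t))
    |pre| : length pre ≡ length u + suc a
    |pre| = trans (length-++ u) (cong (λ l → length u + suc l) (length-replicate a))
    N-after : ∀ {x} → x ∈ t → x ≡ N → ⊥
    N-after x∈t refl with ∈⇒at t x∈t
    ... | i , i<|t| , ai≡x = <⇒≱ (≤∧≢⇒< y≤N y≢N) (subst₂ _≤_ ar≡N aq≡y
      (condition p q r (subst (1 ≤_) (+-comm 1 (length u)) (s≤s z≤n)) p<q q<r r≤|w| (trans ap≡N (sym ar≡N))))
      where
        p q r : ℕ
        p = length u + 1
        q = length pre + 1
        r = length pre + suc (suc i)
        ap≡N : at w p ≡ N
        ap≡N = at-++ʳ u (N ∷ (replicate a N ++ y ∷ t)) 0
        aq≡y : at w q ≡ y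
        aq≡y = trans (cong (λ l → at l q) w≡) (at-++ʳ pre (y ∷ t) 0)
        ar≡N : at w r ≡ N
        ar≡N = trans (cong (λ l → at l r) w≡) (trans (at-++ʳ pre (y ∷ t) (suc i)) ai≡x)
        p<q : p < q
        p<q = subst (p <_) (cong (_+ 1) (sym |pre|)) (+-monoˡ-< 1 (m<m+n (length u) z<s))
        q<r : q < r
        q<r = +-monoʳ-< (length pre) (s<s z<s)
        r≤|w| : r ≤ length w
        r≤|w| = subst (r ≤_) (sym (trans (cong length w≡) (length-++ pre))) (+-monoʳ-≤ (length pre) (s≤s i<|t|))

record BlockDecomposition (k n : ℕ) (w' : List ℕ) : Set where
  field
    u v   : List ℕ
    u<N   : All (_< suc n) u
    v<N   : All (_< suc n) v
    shape : w' ≡ u ++ (replicate k (suc n) ++ v)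

block-decomposition : ∀ {k' n w'} → IsStirling (suc k') (suc n) w' → BlockDecomposition (suc k') n w'
block-decomposition {k'} {n} {w'} (alphabet , multiplicities , condition)
  with split-at-first (suc n) w' (multiplicity-positive (suc n) w' (subst (1 ≤_) (sym (multiplicities (suc n) (s≤s z≤n) ≤-refl)) (s≤s z≤n)))
... | u , rest , w'≡ , u∌N with split-run (suc n) rest
...   | a , v , rest≡ , stop = record
  { u = u ; v = v
  ; u<N = below u (All.++⁻ˡ u in-alphabet) u∌N
  ; v<N = below v v-alphabet (v∌N v stop refl)
  ; shape = trans shape₀ (cong (λ b → u ++ (replicate b N ++ v)) run-length) }
  where
    k N : ℕ
    k = suc k'
    N = suc n
    shape₀ : w' ≡ u ++ (replicate (suc a) N ++ v)
    shape₀ = trans w'≡ (cong (λ s → u ++ N ∷ s) rest≡)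
    in-alphabet : All (InAlphabet N) (u ++ (replicate (suc a) N ++ v))
    in-alphabet = subst (All (InAlphabet N)) shape₀ alphabet
    v-alphabet : All (InAlphabet N) v
    v-alphabet = All.++⁻ʳ (replicate (suc a) N) (All.++⁻ʳ u in-alphabet)
    v∌N : ∀ v′ → ¬ StartsWith N v′ → v′ ≡ v → All (λ x → ¬ x ≡ N) v′
    v∌N []      _   _    = []
    v∌N (y ∷ t) y≢N refl = y≢N ∷ no-N-after-run N u a y t (subst StirlingPattern shape₀ condition) (proj₂ (All.head v-alphabet)) y≢N
    run-length : suc a ≡ k
    run-length = trans (sym (BlockMultiplicities.of-N N (suc a) u v u∌N (v∌N v stop refl)))
                       (trans (cong (multiplicity N) (sym shape₀)) (multiplicities N (s≤s z≤n) ≤-refl))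
    below : ∀ l → All (InAlphabet N) l → All (λ x → ¬ x ≡ N) l → All (_< N) l
    below l in-l l∌N = All.zipWith (λ (x∈ , x≢N) → ≤∧≢⇒< (proj₂ x∈) x≢N) (in-l , l∌N)

remove-block : ∀ {k' n} u v → All (_< suc n) u → All (_< suc n) v →
  IsStirling (suc k') (suc n) (u ++ (replicate (suc k') (suc n) ++ v)) → IsStirling (suc k') n (u ++ v)
remove-block {k'} {n} u v u<N v<N (alphabet , multiplicities , condition) =
  All.++⁺ (narrow (All.++⁻ˡ u alphabet) u<N) (narrow (All.++⁻ʳ (replicate (suc k') (suc n)) (All.++⁻ʳ u alphabet)) v<N) ,
  (λ i 1≤i i≤n → trans (sym (BlockMultiplicities.of-other (suc n) (suc k') u v i (<⇒≢ (s≤s i≤n))))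
                       (multiplicities i 1≤i (m≤n⇒m≤1+n i≤n))) ,
  BlockInsertion.pattern-pullback n k' u v u<N v<N condition
  where
    narrow : ∀ {l} → All (InAlphabet (suc n)) l → All (_< suc n) l → All (InAlphabet n) l
    narrow in-l l<N = All.zipWith (λ (x∈ , x<N) → proj₁ x∈ , s≤s⁻¹ x<N) (in-l , l<N)

map-unique : ∀ {A B : Set} (f : A → B) xs → Unique xs →
  (∀ {x y} → x ∈ xs → y ∈ xs → f x ≡ f y → x ≡ y) → Unique (map f xs)
map-unique f []       _                 _          = []
map-unique f (x ∷ xs) (x∉xs ∷ unique) injective =
  All.map⁺ (All.tabulate (λ y∈xs fx≡fy → All.lookup x∉xs y∈xs (injective (here refl) (there y∈xs) fx≡fy))) ∷
  map-unique f xs unique (λ x∈ y∈ → injective (there x∈) (there y∈))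

concatMap-unique : ∀ {A B : Set} (f : A → List B) xs → Unique xs → (∀ {x} → x ∈ xs → Unique (f x)) →
  (∀ {x y z} → x ∈ xs → y ∈ xs → z ∈ f x → z ∈ f y → x ≡ y) → Unique (concatMap f xs)
concatMap-unique f []       _                _      _        = []
concatMap-unique f (x ∷ xs) (x∉xs ∷ unique) pieces disjoint =
  Unique.++⁺ (pieces (here refl)) (concatMap-unique f xs unique (λ y∈ → pieces (there y∈)) (λ x∈ y∈ → disjoint (there x∈) (there y∈)))
    (λ (z∈fx , z∈rest) → let (y , y∈xs , z∈fy) = find (∈-concatMap⁻ f {xs = xs} z∈rest) in
                          All.lookup x∉xs y∈xs (disjoint (here refl) (there y∈xs) z∈fx z∈fy))

-- The block insertion can be undone: deleting the letter N recovers the word,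
-- and the position of the first N recovers the gap.
deleteAll : ℕ → List ℕ → List ℕ
deleteAll N []      = []
deleteAll N (a ∷ l) = if a ≡ᵇ N then deleteAll N l else a ∷ deleteAll N l

firstIndex : ℕ → List ℕ → ℕ
firstIndex N []      = 0
firstIndex N (a ∷ l) = if a ≡ᵇ N then 0 else suc (firstIndex N l)

deleteAll-++ : ∀ N u v → deleteAll N (u ++ v) ≡ deleteAll N u ++ deleteAll N v
deleteAll-++ N []      v = refl
deleteAll-++ N (a ∷ u) v with a ≡ᵇ N
... | true  = deleteAll-++ N u v
... | false = cong (a ∷_) (deleteAll-++ N u v)

deleteAll-replicate : ∀ N k → deleteAll N (replicate k N) ≡ []
deleteAll-replicate N zero    = refl
deleteAll-replicate N (suc k) rewrite ≡ᵇ-true (refl {x = N}) = deleteAll-replicate N k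

deleteAll-absent : ∀ N l → All (_< N) l → deleteAll N l ≡ l
deleteAll-absent N []      []           = refl
deleteAll-absent N (a ∷ l) (a<N ∷ l<N) rewrite ≡ᵇ-false (<⇒≢ a<N) = cong (a ∷_) (deleteAll-absent N l l<N)

firstIndex-++ : ∀ N u rest → All (_< N) u → firstIndex N (u ++ N ∷ rest) ≡ length u
firstIndex-++ N []      rest []           rewrite ≡ᵇ-true (refl {x = N}) = refl
firstIndex-++ N (a ∷ u) rest (a<N ∷ u<N) rewrite ≡ᵇ-false (<⇒≢ a<N) = cong suc (firstIndex-++ N u rest u<N)

module _ {k' N : ℕ} {w : List ℕ} (w<N : All (_< N) w) where

  deleteAll-insertBlock : ∀ g → deleteAll N (insertBlock (suc k') N g w) ≡ w
  deleteAll-insertBlock g = begin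
    deleteAll N (take g w ++ (replicate (suc k') N ++ drop g w))
      ≡⟨ deleteAll-++ N (take g w) _ ⟩
    deleteAll N (take g w) ++ deleteAll N (replicate (suc k') N ++ drop g w)
      ≡⟨ cong (deleteAll N (take g w) ++_) (deleteAll-++ N (replicate (suc k') N) (drop g w)) ⟩
    deleteAll N (take g w) ++ (deleteAll N (replicate (suc k') N) ++ deleteAll N (drop g w))
      ≡⟨ cong₂ (λ a b → a ++ (b ++ deleteAll N (drop g w))) (deleteAll-absent N (take g w) (All.take⁺ g w<N)) (deleteAll-replicate N (suc k')) ⟩
    take g w ++ deleteAll N (drop g w)
      ≡⟨ cong (take g w ++_) (deleteAll-absent N (drop g w) (All.drop⁺ g w<N)) ⟩
    take g w ++ drop g w
      ≡⟨ take++drop≡id g w ⟩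
    w ∎
    where open ≡-Reasoning

  firstIndex-insertBlock : ∀ g → g ≤ length w → firstIndex N (insertBlock (suc k') N g w) ≡ g
  firstIndex-insertBlock g g≤|w| =
    trans (firstIndex-++ N (take g w) _ (All.take⁺ g w<N)) (trans (length-take g w) (m≤n⇒m⊓n≡m g≤|w|))

take-length-++ : ∀ (u v : List ℕ) → take (length u) (u ++ v) ≡ u
take-length-++ []      v = refl
take-length-++ (x ∷ u) v = cong (x ∷_) (take-length-++ u v)

drop-length-++ : ∀ (u v : List ℕ) → drop (length u) (u ++ v) ≡ v
drop-length-++ []      v = refl
drop-length-++ (x ∷ u) v = drop-length-++ u v

insertions : ℕ → ℕ → List ℕ → List (List ℕ)
insertions k N w = map (λ g → insertBlock k N g w) (upTo (suc (length w)))

stirlings : ℕ → ℕ → List (List ℕ)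
stirlings k zero    = [] ∷ []
stirlings k (suc n) = concatMap (insertions k (suc n)) (stirlings k n)

empty-stirling : ∀ k → IsStirling k 0 []
empty-stirling k = [] , (λ i 1≤i i≤0 → ⊥-elim (<⇒≱ 1≤i i≤0)) , (λ p q r _ _ q<r r≤0 _ → ⊥-elim (<⇒≱ (≤-<-trans z≤n q<r) r≤0))

stirling-order-0 : ∀ k w → IsStirling k 0 w → w ≡ []
stirling-order-0 k []      _                          = refl
stirling-order-0 k (a ∷ w) (((1≤a , a≤0) ∷ _) , _) = ⊥-elim (<⇒≱ 1≤a a≤0)

-- Every k-Stirling permutation of order n+1 arises from exactly one of order n
-- by inserting N^k into exactly one gap, so stirlings enumerates them.
stirlings-enumerate : ∀ k' n → Enumerates (IsStirling (suc k') n) (stirlings (suc k') n)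
stirlings-enumerate k' zero = ([] ∷ []) , λ w → mk⇔
  (λ { (here refl) → empty-stirling (suc k') })
  (λ stirling → here (stirling-order-0 (suc k') w stirling))
stirlings-enumerate k' (suc n) = unique , λ w' → mk⇔ (member⇒stirling w') (stirling⇒member w')
  where
    k N : ℕ
    k = suc k'
    N = suc n
    previous = stirlings-enumerate k' n
    smaller : ∀ {w} → w ∈ stirlings k n → IsStirling k n w
    smaller {w} w∈ = Equivalence.to (proj₂ previous w) w∈
    below : ∀ {w} → w ∈ stirlings k n → All (_< N) w
    below w∈ = Stirling.letters<n+1 (smaller w∈)
    unique : Unique (stirlings k (suc n))
    unique = concatMap-unique (insertions k N) (stirlings k n) (proj₁ previous)
      (λ {w} w∈ → map-unique (λ g → insertBlock k N g w) (upTo (suc (length w))) (Unique.upTo⁺ _)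
         (λ {g₁} {g₂} g₁∈ g₂∈ same → trans (sym (firstIndex-insertBlock {k'} (below w∈) g₁ (s≤s⁻¹ (∈-upTo⁻ g₁∈))))
                                       (trans (cong (firstIndex N) same) (firstIndex-insertBlock {k'} (below w∈) g₂ (s≤s⁻¹ (∈-upTo⁻ g₂∈))))))
      (λ {w₁} {w₂} w₁∈ w₂∈ w'∈₁ w'∈₂ →
         let (g₁ , _ , w'≡₁) = ∈-map⁻ (λ g → insertBlock k N g w₁) {xs = upTo (suc (length w₁))} w'∈₁
             (g₂ , _ , w'≡₂) = ∈-map⁻ (λ g → insertBlock k N g w₂) {xs = upTo (suc (length w₂))} w'∈₂ in
         trans (sym (deleteAll-insertBlock {k'} (below w₁∈) g₁))
               (trans (cong (deleteAll N) (trans (sym w'≡₁) w'≡₂)) (deleteAll-insertBlock {k'} (below w₂∈) g₂)))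
    member⇒stirling : ∀ w' → w' ∈ stirlings k (suc n) → IsStirling k N w'
    member⇒stirling w' w'∈ with find (∈-concatMap⁻ (insertions k N) {xs = stirlings k n} w'∈)
    ... | w , w∈ , w'∈ins with ∈-map⁻ (λ g → insertBlock k N g w) {xs = upTo (suc (length w))} w'∈ins
    ...   | g , _ , refl = insert-stirling (take g w) (drop g w) (subst (IsStirling k n) (sym (take++drop≡id g w)) (smaller w∈))
    stirling⇒member : ∀ w' → IsStirling k N w' → w' ∈ stirlings k (suc n)
    stirling⇒member w' stirling = subst (_∈ stirlings k (suc n)) (sym shape)
      (∈-concatMap⁺ (insertions k N) (lose w∈ (subst (_∈ insertions k N (u ++ v)) reinsert (∈-map⁺ _ (∈-upTo⁺ gap-in-range)))))
      where
        open BlockDecomposition (block-decomposition stirling)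
        w∈ : u ++ v ∈ stirlings k n
        w∈ = Equivalence.from (proj₂ previous (u ++ v)) (remove-block u v u<N v<N (subst (IsStirling k N) shape stirling))
        gap-in-range : length u < suc (length (u ++ v))
        gap-in-range = s≤s (subst (length u ≤_) (sym (length-++ u)) (m≤m+n (length u) (length v)))
        reinsert : insertBlock k N (length u) (u ++ v) ≡ u ++ (replicate k N ++ v)
        reinsert = cong₂ (λ a b → a ++ (replicate k N ++ b)) (take-length-++ u v) (drop-length-++ u v)

sum-applyUpTo : ∀ (h : ℕ → ℕ) m → sum (applyUpTo h m) ≡ sumBelow h m
sum-applyUpTo h zero    = refl
sum-applyUpTo h (suc m) = cong (h 0 +_) (sum-applyUpTo (λ i → h (suc i)) m)

sum-concatMap : ∀ {A B : Set} (F : B → ℕ) (f : A → List B) xs →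
  sum (map F (concatMap f xs)) ≡ sum (map (λ x → sum (map F (f x))) xs)
sum-concatMap F f []       = refl
sum-concatMap F f (x ∷ xs) =
  trans (cong sum (map-++ F (f x) _)) (trans (sum-++ (map F (f x)) _) (cong (sum (map F (f x)) +_) (sum-concatMap F f xs)))

length-concatMap : ∀ {A B : Set} (f : A → List B) xs → length (concatMap f xs) ≡ sum (map (λ x → length (f x)) xs)
length-concatMap f []       = refl
length-concatMap f (x ∷ xs) = trans (length-++ (f x)) (cong (length (f x) +_) (length-concatMap f xs))

sum-insertions : ∀ (F : List ℕ → ℕ) k N w →
  sum (map F (insertions k N w)) ≡ sumBelow (λ g → F (insertBlock k N g w)) (suc (length w))
sum-insertions F k N w =
  trans (cong sum (sym (map-∘ (upTo (suc (length w)))))) (trans (cong sum (map-upTo _ (suc (length w)))) (sum-applyUpTo (λ g → F (insertBlock k N g w)) (suc (length w))))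

sum-map-affine : ∀ {A : Set} (F : A → ℕ) c d (xs : List A) → sum (map (λ x → c * F x + d) xs) ≡ c * sum (map F xs) + d * length xs
sum-map-affine F c d []       = sym (trans (cong (_+ d * 0) (*-zeroʳ c)) (*-zeroʳ d))
sum-map-affine F c d (x ∷ xs) = trans (cong (c * F x + d +_) (sum-map-affine F c d xs)) (affine c (F x) d (sum (map F xs)) (length xs))
  where
    affine : ∀ c a d s l → c * a + d + (c * s + d * l) ≡ c * (a + s) + d * suc l
    affine = solve-∀

module StirlingTotals (k' : ℕ) where
  k : ℕ
  k = suc k'

  total : (List ℕ → ℕ) → ℕ → ℕ
  total F n = sum (map F (stirlings k n))

  number : ℕ → ℕ
  number n = length (stirlings k n)

  private
    stirling : ∀ {n w} → w ∈ stirlings k n → IsStirling k n w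
    stirling {n} {w} w∈ = Equivalence.to (proj₂ (stirlings-enumerate k' n) w) w∈

  -- A permutation of order n has kn+1 gaps.
  number-suc : ∀ n → number (suc n) ≡ suc (k * n) * number n
  number-suc n = begin
    length (concatMap (insertions k (suc n)) (stirlings k n))
      ≡⟨ length-concatMap (insertions k (suc n)) (stirlings k n) ⟩
    sum (map (λ w → length (insertions k (suc n) w)) (stirlings k n))
      ≡⟨ sum-map-cong _ (λ _ → suc (k * n)) (stirlings k n) (λ {w} w∈ →
           trans (length-map _ (upTo (suc (length w)))) (trans (length-upTo (suc (length w))) (cong suc (Stirling.length-kn (stirling w∈))))) ⟩
    sum (map (λ _ → suc (k * n)) (stirlings k n))
      ≡⟨ sum-map-const (suc (k * n)) (stirlings k n) ⟩
    suc (k * n) * number n ∎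
    where open ≡-Reasoning

  total-suc : ∀ (F : List ℕ → ℕ) D n →
    (∀ w → IsStirling k n w → sumBelow (λ g → F (insertBlock k (suc n) g w)) (suc (length w)) ≡ length w * F w + D) →
    total F (suc n) ≡ k * n * total F n + D * number n
  total-suc F D n insertion-sum = begin
    sum (map F (concatMap (insertions k (suc n)) (stirlings k n)))
      ≡⟨ sum-concatMap F (insertions k (suc n)) (stirlings k n) ⟩
    sum (map (λ w → sum (map F (insertions k (suc n) w))) (stirlings k n))
      ≡⟨ sum-map-cong _ (λ w → k * n * F w + D) (stirlings k n) (λ {w} w∈ → let st = stirling w∈ in
           trans (sum-insertions F k (suc n) w) (trans (insertion-sum w st) (cong (λ l → l * F w + D) (Stirling.length-kn st)))) ⟩
    sum (map (λ w → k * n * F w + D) (stirlings k n))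
      ≡⟨ sum-map-affine F (k * n) D (stirlings k n) ⟩
    k * n * total F n + D * number n ∎
    where open ≡-Reasoning

  mean-by-insertion : ∀ (F : List ℕ → ℕ) (E D : ℕ → ℕ) →
    (∀ n w → IsStirling k n w → sumBelow (λ g → F (insertBlock k (suc n) g w)) (suc (length w)) ≡ length w * F w + D n) →
    (∀ n → E (suc n) * suc (k * n) ≡ k * n * E n + suc k * D n) →
    ∀ n → suc k * total F (suc n) ≡ E (suc n) * number (suc n)
  mean-by-insertion F E D insertion-sum recurrence n = begin
    suc k * total F (suc n)
      ≡⟨ cong (suc k *_) (total-suc F (D n) n (insertion-sum n)) ⟩
    suc k * (k * n * T + D n * C)
      ≡⟨ distribute (suc k) (k * n) T (D n) C ⟩
    k * n * (suc k * T) + suc k * D n * C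
      ≡⟨ cong (_+ suc k * D n * C) (previous n) ⟩
    k * n * (E n * C) + suc k * D n * C
      ≡⟨ collect (k * n) (E n) (suc k) (D n) C ⟩
    (k * n * E n + suc k * D n) * C
      ≡⟨ cong (_* C) (recurrence n) ⟨
    E (suc n) * suc (k * n) * C
      ≡⟨ trans (*-assoc (E (suc n)) (suc (k * n)) C) (cong (E (suc n) *_) (sym (number-suc n))) ⟩
    E (suc n) * number (suc n) ∎
    where
      open ≡-Reasoning
      T C : ℕ
      T = total F n
      C = number n
      distribute : ∀ K a t d c → K * (a * t + d * c) ≡ a * (K * t) + K * d * c
      distribute = solve-∀
      collect : ∀ a e K d c → a * (e * c) + K * d * c ≡ (a * e + K * d) * c
      collect = solve-∀
      -- For n = 0 the factor k·n vanishes; otherwise this is the induction hypothesis.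
      previous : ∀ n → k * n * (suc k * total F n) ≡ k * n * (E n * number n)
      previous zero    = trans (cong (λ z → z * (suc k * total F 0)) (*-zeroʳ k)) (sym (cong (λ z → z * (E 0 * number 0)) (*-zeroʳ k)))
      previous (suc m) = cong (k * suc m *_) (mean-by-insertion F E D insertion-sum recurrence m)

module InsertionSums (k' n : ℕ) {w : List ℕ} (stirling : IsStirling (suc k') n w) where
  open Stirling stirling

  k : ℕ
  k = suc k'

  insert : ℕ → List ℕ
  insert g = insertBlock k (suc n) g w

  private
    module Gap g g≤|w| = GapEffect n k' w letters<n+1 g g≤|w|

    constant-gain : ∀ (F : List ℕ → ℕ) Q c → F w ≡ localCount Q w →
      (∀ g → g ≤ length w → F (insert g) + 𝟙 (localAt Q w g) ≡ F w + c) →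
      sumBelow (λ g → F (insert g)) (suc (length w)) ≡ length w * F w + suc (k * n) * c
    constant-gain F Q c F-local gain = trans (sum-over-gaps F Q insert (λ _ → c) w F-local gain)
      (cong (length w * F w +_) (trans (sumBelow-const c (suc (length w))) (cong (λ l → suc l * c) length-kn)))

  ascents : sumBelow (λ g → Xstat (insert g)) (suc (length w)) ≡ length w * Xstat w + suc (k * n) * 1
  ascents = constant-gain Xstat ascent 1 (Xstat-local w) Gap.ascents

  descents : sumBelow (λ g → Ystat (insert g)) (suc (length w)) ≡ length w * Ystat w + suc (k * n) * 1
  descents = constant-gain Ystat descent 1 (Ystat-local w) Gap.descents

  plateaux : sumBelow (λ g → Zstat (insert g)) (suc (length w)) ≡ length w * Zstat w + suc (k * n) * k'
  plateaux = constant-gain Zstat plateau k' (Zstat-local w) Gap.plateaux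

  jPlateaux : ∀ j → 1 ≤ j → j ≤ k' → sumBelow (λ g → Zj j (insert g)) (suc (length w)) ≡ length w * Zj j w + suc (k * n) * 1
  jPlateaux j 1≤j j≤k' = constant-gain (Zj j) (jPlateau j) 1 (Zj-local j w 1≤j) (λ g g≤|w| → Gap.jPlateaux g g≤|w| j 1≤j j≤k')

  -- The j-ascents (j-descents) gained are the j-th occurrences before (after) the gaps.
  jAscents : ∀ j → 1 ≤ j → j ≤ k → sumBelow (λ g → Xj j (insert g)) (suc (length w)) ≡ length w * Xj j w + n
  jAscents j 1≤j j≤k =
    trans (sum-over-gaps (Xj j) (jAscent j) insert (λ g → 𝟙 (occ w g ≡ᵇ j)) w (Xj-local j w 1≤j) (λ g g≤|w| → Gap.jAscents g g≤|w| j 1≤j))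
          (cong (length w * Xj j w +_) (jth-occurrences-before-gaps j 1≤j j≤k))

  jDescents : ∀ j → 1 ≤ j → j ≤ k → sumBelow (λ g → Yj j (insert g)) (suc (length w)) ≡ length w * Yj j w + n
  jDescents j 1≤j j≤k =
    trans (sum-over-gaps (Yj j) (jDescent j) insert (λ g → 𝟙 ((0 <ᵇ at w (suc g)) ∧ (occ w (suc g) ≡ᵇ j))) w (Yj-local j w positive)
                         (λ g g≤|w| → Gap.jDescents g g≤|w| j positive))
          (cong (length w * Yj j w +_) (jth-occurrences-after-gaps j 1≤j j≤k))

stirling-mean : ∀ {k' n} ws → Enumerates (IsStirling (suc k') (suc n)) ws → (F : List ℕ → ℕ) (E D : ℕ → ℕ) →
  (∀ m w → IsStirling (suc k') m w → sumBelow (λ g → F (insertBlock (suc k') (suc m) g w)) (suc (length w)) ≡ length w * F w + D m) →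
  (∀ m → E (suc m) * suc (suc k' * m) ≡ suc k' * m * E m + suc (suc k') * D m) →
  suc (suc k') * sum (map F ws) ≡ E (suc n) * length ws
stirling-mean {k'} {n} ws enum F E D insertion-sum recurrence = begin
  suc (suc k') * sum (map F ws)                      ≡⟨ cong (suc (suc k') *_) (enumerations-sum enum generated F) ⟩
  suc (suc k') * total F (suc n)                     ≡⟨ mean-by-insertion F E D insertion-sum recurrence n ⟩
  E (suc n) * number (suc n)                         ≡⟨ cong (E (suc n) *_) (enumerations-length enum generated) ⟨
  E (suc n) * length ws                              ∎
  where
    open ≡-Reasoning
    open StirlingTotals k'
    generated = stirlings-enumerate k' (suc n)

-- The claimed means E n satisfy E (n+1) · (kn+1) = kn · E n + (k+1) · D n, where
-- D n is the gain per word of order n.  For j-ascents and j-descents E n = n-1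
-- and D n = n ...
recurrence-occurrences : ∀ k m → (suc m ∸ 1) * suc (k * m) ≡ k * m * (m ∸ 1) + suc k * m
recurrence-occurrences k zero    = identity₀ k
  where
    identity₀ : ∀ k → 0 * suc (k * 0) ≡ k * 0 * 0 + suc k * 0
    identity₀ = solve-∀
recurrence-occurrences k (suc m) = identity k m
  where
    identity : ∀ k m → suc m * suc (k * suc m) ≡ k * suc m * m + suc k * suc m
    identity = solve-∀

-- ... for ascents, descents and j-plateaux E n = kn+1 and D n = kn+1 ...
recurrence-pairs : ∀ k m → (k * suc m + 1) * suc (k * m) ≡ k * m * (k * m + 1) + suc k * (suc (k * m) * 1)
recurrence-pairs = solve-∀

-- ... and for plateaux E n = (k-1)(kn+1) and D n = (kn+1)(k-1).
recurrence-plateaux : ∀ k' m → k' * (suc k' * suc m + 1) * suc (suc k' * m) ≡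
                              suc k' * m * (k' * (suc k' * m + 1)) + suc (suc k') * (suc (suc k' * m) * k')
recurrence-plateaux = solve-∀

theorem5p2 : (k n : ℕ) → 1 ≤ k → 1 ≤ n →
    (ts : List (List (ℕ × ℕ))) → Enumerates (IsIncTree k n) ts →
    (ws : List (List ℕ)) → Enumerates (IsStirling k n) ws →
    ((j : ℕ) → 1 ≤ j → j ≤ suc k →
        suc k * sum (map (Lstat n j) ts) ≡ (k * n + 1) * length ts) ×
    ((j : ℕ) → 1 ≤ j → j ≤ suc k →
        suc k * sum (map (Dstat j) ts) ≡ (n ∸ 1) * length ts) ×
    ((j : ℕ) → 1 ≤ j → j ≤ k →
        suc k * sum (map (Xj j) ws) ≡ (n ∸ 1) * length ws) ×
    ((j : ℕ) → 1 ≤ j → j ≤ k →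
        suc k * sum (map (Yj j) ws) ≡ (n ∸ 1) * length ws) ×
    ((j : ℕ) → 1 ≤ j → j ≤ k ∸ 1 →
        suc k * sum (map (Zj j) ws) ≡ (k * n + 1) * length ws) ×
    (suc k * sum (map Xstat ws) ≡ (k * n + 1) * length ws) ×
    (suc k * sum (map Ystat ws) ≡ (k * n + 1) * length ws) ×
    (suc k * sum (map Zstat ws) ≡ (k ∸ 1) * (k * n + 1) * length ws)
theorem5p2 (suc k') (suc n) _ 1≤n ts trees ws perms =
  tree-mean {n = suc n} (k * suc n + 1) (Lstat (suc n)) (Lstat-swap (suc n)) (λ t tree → Lstat-total t 1≤n tree) ts trees ,
  tree-mean {n = suc n} n Dstat Dstat-swap (λ t tree → trans (Dstat-total t (edges-in-range {n = suc n} t tree)) (proj₁ tree)) ts trees ,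
  (λ j 1≤j j≤k → stirling-mean ws perms (Xj j) (_∸ 1) (λ m → m)
                   (λ m w st → InsertionSums.jAscents k' m st j 1≤j j≤k) (recurrence-occurrences k)) ,
  (λ j 1≤j j≤k → stirling-mean ws perms (Yj j) (_∸ 1) (λ m → m)
                   (λ m w st → InsertionSums.jDescents k' m st j 1≤j j≤k) (recurrence-occurrences k)) ,
  (λ j 1≤j j≤k' → stirling-mean ws perms (Zj j) (λ m → k * m + 1) (λ m → suc (k * m) * 1)
                    (λ m w st → InsertionSums.jPlateaux k' m st j 1≤j j≤k') (recurrence-pairs k)) ,
  stirling-mean ws perms Xstat (λ m → k * m + 1) (λ m → suc (k * m) * 1)
    (λ m w st → InsertionSums.ascents k' m st) (recurrence-pairs k) ,
  stirling-mean ws perms Ystat (λ m → k * m + 1) (λ m → suc (k * m) * 1)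
    (λ m w st → InsertionSums.descents k' m st) (recurrence-pairs k) ,
  stirling-mean ws perms Zstat (λ m → k' * (k * m + 1)) (λ m → suc (k * m) * k')
    (λ m w st → InsertionSums.plateaux k' m st) (recurrence-plateaux k')
  where
    k : ℕ
    k = suc k'
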